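{- There is a translation $p\mapsto\hat p$ from the set $\mathcal{P}$ of polynomials $p(x)=\sum_{i=0}^{\vartheta}a_ix^i$ with natural-number coefficients (with $\vartheta$ the maximal degree with non-null coefficient) to terms of $\Lambda$ such that, for every such $p$: (a) $\vdash\hat p:\boldsymbol{Int}\multimap\S^{\vartheta+3}\boldsymbol{Int}$ is derivable; (b) for all $n,m\in\mathbb{N}$, $p(n)=m$ if and only if $\hat p\,\overline{n}\leadsto^*\S^{\vartheta+3}\overline{m}$.
   Context: Terms of $\Lambda$: patterns $\mathsf P::=x\mid \mathsf P\otimes\mathsf P$ ($x$ a variable); terms $M::=x\mid \lambda\mathsf P.M\mid MN\mid M\otimes N\mid !M\mid \overline{!}M\mid \S M\mid \overline{\S}M$, up to $\alpha$-equivalence ($\lambda$ binds the variables of the pattern). $\leadsto$ is the contextual closure of $(\lambda x_1\otimes\dots\otimes x_m.M)(M_1\otimes\dots\otimes M_m)\to M[M_1/x_1,\dots,M_m/x_m]$ ($m\ge1$), $\overline{!}\,!M\to M$, $\overline{\S}\,\S M\to M$; $\leadsto^*$ is its reflexive–transitive closure. $\S^kM$ denotes $k$ nested applications of $\S$. Types are ILAL formulas $A::=\alpha\mid A\multimap A\mid A\otimes A\mid !A\mid\S A\mid\forall\alpha.A$. Typing judgments $\Gamma\vdash M:A$ ($\Gamma$ a finite set of assumptions $x:A$ or $\mathsf P:A$ with distinct variables) are derived by: $x:B\vdash x:B$; Cut: from $\Gamma\vdash M:A$ and $\Delta,x:A\vdash N:B$ infer $\Gamma,\Delta\vdash N[M/x]:B$;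 Weakening: from $\Gamma\vdash M:B$ infer $\Gamma,x:A\vdash M:B$; Contraction: from $\Gamma,x:!A,y:!A\vdash M:B$ infer $\Gamma,z:!A\vdash M[z/x,z/y]:B$; $\multimap_l$: from $\Gamma\vdash M:A$ and $\Delta,y:B\vdash N:C$ infer $\Gamma,\Delta,x:A\multimap B\vdash N[xM/y]:C$; $\multimap_r$: from $\Gamma,\mathsf P:B_1\otimes\dots\otimes B_n\vdash M:B$ infer $\Gamma\vdash\lambda\mathsf P.M:B_1\otimes\dots\otimes B_n\multimap B$; $\otimes_l$: from $\Gamma,x_1:B_1,x_2:B_2\vdash M:B$ infer $\Gamma,x_1\otimes x_2:B_1\otimes B_2\vdash M:B$; $\otimes_r$: from $\Gamma\vdash M:B$, $\Delta\vdash N:A$ infer $\Gamma,\Delta\vdash M\otimes N:B\otimes A$; $!$: from $\Gamma\vdash M:B$ with $\Gamma$ containing at most one assumption $x:A$ infer $x:!A\vdash !M[\overline{!}x/x]:!B$; $\S$: from $x_1:B_1,\dots,x_m:B_m,x'_1:A_1,\dots,x'_n:A_n\vdash M:B$ infer $x_i:!B_i,x'_j:\S A_j\vdash \S M[\overline{!}x_i/x_i,\overline{\S}x'_j/x'_j]:\S B$; $\forall_l$: from $\Gamma,x:A[B/\alpha]\vdash M:C$ infer $\Gamma,x:\forall\alpha.A\vdash M:C$; $\forall_r$: from $\Gamma\vdash M:A$ with $\alpha$ not free in $\Gamma$ infer $\Gamma\vdash M:\forall\alpha.A$. Integers: $\boldsymbol{Int}=\forall\alpha.!(\alpha\multimap\alpha)\multimap\S(\alpha\multimap\alpha)$,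 $\overline{0}=\lambda x.\S\lambda y.y$, and $\overline{n}=\lambda x.\S(\lambda y.\overline{!}x(\cdots(\overline{!}x\,y)\cdots))$ with $n$ occurrences of $\overline{!}x$. -}

module Defs where

open import Data.Nat using (ℕ; zero; suc; _+_; _*_; _∸_; _⊔_; _≡ᵇ_; _<ᵇ_; pred)
open import Data.Bool using (Bool; true; false; if_then_else_)
open import Data.List using (List; []; _∷_; _++_; map; concat; length; zip; foldr; [_])
open import Data.List.Relation.Unary.Unique.Propositional using (Unique)
open import Data.List.Relation.Binary.Permutation.Propositional using (_↭_)
open import Data.Maybe using (Maybe; just; nothing)
open import Data.Product using (Σ; ∃; _×_; _,_; proj₁; proj₂)
open import Data.Sum using (_⊎_)
open import Data.Unit using (⊤)
open import Relation.Binary.PropositionalEquality using (_≡_)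
open import Relation.Nullary using (¬_)
open import Relation.Binary.Construct.Closure.ReflexiveTransitive using (Star)

data Pat : Set where
  pvar  : ℕ → Pat
  ptens : Pat → Pat → Pat

data Tm : Set where
  var    : ℕ → Tm
  lam    : Pat → Tm → Tm
  app    : Tm → Tm → Tm
  tens   : Tm → Tm → Tm
  bang   : Tm → Tm
  unbang : Tm → Tm
  para   : Tm → Tm
  unpara : Tm → Tm

patVars : Pat → List ℕ
patVars (pvar x)    = [ x ]
patVars (ptens P Q) = patVars P ++ patVars Q

allVars : Tm → List ℕ
allVars (var x)    = [ x ]
allVars (lam P M)  = patVars P ++ allVars M
allVars (app M N)  = allVars M ++ allVars N
allVars (tens M N) = allVars M ++ allVars N
allVars (bang M)   = allVars M
allVars (unbang M) = allVars M
allVars (para M)   = allVars M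
allVars (unpara M) = allVars M

maxL : List ℕ → ℕ
maxL = foldr _⊔_ 0

-- simultaneous substitutions (earlier entries shadow later ones)
Sub : Set
Sub = List (ℕ × Tm)

lookupS : Sub → ℕ → Tm
lookupS []            x = var x
lookupS ((y , t) ∷ σ) x = if x ≡ᵇ y then t else lookupS σ x

subVars : Sub → List ℕ
subVars []            = []
subVars ((y , t) ∷ σ) = y ∷ allVars t ++ subVars σ

freshen : Pat → ℕ → Pat × ℕ
freshen (pvar _)    k = pvar k , suc k
freshen (ptens P Q) k with freshen P k
... | P' , k' with freshen Q k'
...   | Q' , k'' = ptens P' Q' , k''

renameS : List ℕ → List ℕ → Sub
renameS xs ys = zip xs (map var ys)

sub : Sub → Tm → Tm
sub σ (var x)    = lookupS σ x
sub σ (lam P M)  =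
  let P' = proj₁ (freshen P (suc (maxL (patVars P ++ allVars M ++ subVars σ))))
  in lam P' (sub (renameS (patVars P) (patVars P') ++ σ) M)
sub σ (app M N)  = app (sub σ M) (sub σ N)
sub σ (tens M N) = tens (sub σ M) (sub σ N)
sub σ (bang M)   = bang (sub σ M)
sub σ (unbang M) = unbang (sub σ M)
sub σ (para M)   = para (sub σ M)
sub σ (unpara M) = unpara (sub σ M)

data SameShape : Pat → Pat → Set where
  sh-var  : ∀ {x y} → SameShape (pvar x) (pvar y)
  sh-tens : ∀ {P P' Q Q'} → SameShape P Q → SameShape P' Q' →
            SameShape (ptens P P') (ptens Q Q')

_∉_ : ℕ → List ℕ → Set
x ∉ xs = ¬ (Data.List.Relation.Unary.Any.Any (x ≡_) xs)
  where import Data.List.Relation.Unary.Any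

Fresh : List ℕ → List ℕ → Set
Fresh zs avoid = Data.List.Relation.Unary.All.All (λ z → z ∉ avoid) zs
  where import Data.List.Relation.Unary.All

infix 4 _=α_
data _=α_ : Tm → Tm → Set where
  α-var    : ∀ {x} → var x =α var x
  α-lam    : ∀ {P Q M N} (zs : List ℕ) →
             SameShape P Q → Unique zs → length zs ≡ length (patVars P) →
             Fresh zs (patVars P ++ patVars Q ++ allVars M ++ allVars N) →
             sub (renameS (patVars P) zs) M =α sub (renameS (patVars Q) zs) N →
             lam P M =α lam Q N
  α-app    : ∀ {M M' N N'} → M =α M' → N =α N' → app M N =α app M' N'
  α-tens   : ∀ {M M' N N'} → M =α M' → N =α N' → tens M N =α tens M' N'
  α-bang   : ∀ {M M'} → M =α M' → bang M =α bang M'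
  α-unbang : ∀ {M M'} → M =α M' → unbang M =α unbang M'
  α-para   : ∀ {M M'} → M =α M' → para M =α para M'
  α-unpara : ∀ {M M'} → M =α M' → unpara M =α unpara M'

match : Pat → Tm → Maybe Sub
match (pvar x)    M          = just [ (x , M) ]
match (ptens P Q) (tens M N) with match P M | match Q N
... | just σ | just τ = just (σ ++ τ)
... | _      | _      = nothing
match (ptens P Q) _          = nothing

infix 4 _⇝_
data _⇝_ : Tm → Tm → Set where
  β       : ∀ {P M N σ} → match P N ≡ just σ → app (lam P M) N ⇝ sub σ M
  β!      : ∀ {M} → unbang (bang M) ⇝ M
  β§      : ∀ {M} → unpara (para M) ⇝ M
  c-lam   : ∀ {P M M'} → M ⇝ M' → lam P M ⇝ lam P M'
  c-appl  : ∀ {M M' N} → M ⇝ M' → app M N ⇝ app M' N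
  c-appr  : ∀ {M N N'} → N ⇝ N' → app M N ⇝ app M N'
  c-tensl : ∀ {M M' N} → M ⇝ M' → tens M N ⇝ tens M' N
  c-tensr : ∀ {M N N'} → N ⇝ N' → tens M N ⇝ tens M N'
  c-bang   : ∀ {M M'} → M ⇝ M' → bang M ⇝ bang M'
  c-unbang : ∀ {M M'} → M ⇝ M' → unbang M ⇝ unbang M'
  c-para   : ∀ {M M'} → M ⇝ M' → para M ⇝ para M'
  c-unpara : ∀ {M M'} → M ⇝ M' → unpara M ⇝ unpara M'

-- reflexive–transitive closure of ⇝ on α-equivalence classes
_⇝α_ : Tm → Tm → Set
M ⇝α N = (M ⇝ N) ⊎ (M =α N)

infix 4 _⇝*_
_⇝*_ : Tm → Tm → Set
_⇝*_ = Star _⇝α_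

paraⁿ : ℕ → Tm → Tm
paraⁿ zero    M = M
paraⁿ (suc k) M = para (paraⁿ k M)

-- numerals: n̄ = λx.§(λy. !̄x (… (!̄x y)…)), here x = 0, y = 1
iterX : ℕ → Tm
iterX zero    = var 1
iterX (suc n) = app (unbang (var 0)) (iterX n)

num : ℕ → Tm
num n = lam (pvar 0) (para (lam (pvar 1) (iterX n)))

-- ILAL types (type variables as de Bruijn indices; ∀ binds index 0)

infixr 5 _⊸_
data Ty : Set where
  tv   : ℕ → Ty
  _⊸_  : Ty → Ty → Ty
  _⊗ₜ_ : Ty → Ty → Ty
  !ₜ   : Ty → Ty
  §ₜ   : Ty → Ty
  ∀ₜ   : Ty → Ty

shiftTy : ℕ → Ty → Ty
shiftTy c (tv k)   = if k <ᵇ c then tv k else tv (suc k)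
shiftTy c (A ⊸ B)  = shiftTy c A ⊸ shiftTy c B
shiftTy c (A ⊗ₜ B) = shiftTy c A ⊗ₜ shiftTy c B
shiftTy c (!ₜ A)   = !ₜ (shiftTy c A)
shiftTy c (§ₜ A)   = §ₜ (shiftTy c A)
shiftTy c (∀ₜ A)   = ∀ₜ (shiftTy (suc c) A)

substTy : ℕ → Ty → Ty → Ty
substTy j B (tv k)   = if k <ᵇ j then tv k else (if k ≡ᵇ j then B else tv (pred k))
substTy j B (A ⊸ C)  = substTy j B A ⊸ substTy j B C
substTy j B (A ⊗ₜ C) = substTy j B A ⊗ₜ substTy j B C
substTy j B (!ₜ A)   = !ₜ (substTy j B A)
substTy j B (§ₜ A)   = §ₜ (substTy j B A)
substTy j B (∀ₜ A)   = ∀ₜ (substTy (suc j) (shiftTy 0 B) A)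

§ⁿ : ℕ → Ty → Ty
§ⁿ zero    A = A
§ⁿ (suc k) A = §ₜ (§ⁿ k A)

IntTy : Ty
IntTy = ∀ₜ (!ₜ (tv 0 ⊸ tv 0) ⊸ §ₜ (tv 0 ⊸ tv 0))

-- Typing (contexts: lists of assumptions P : A, treated as sets via exch)

Hyp : Set
Hyp = Pat × Ty

Ctx : Set
Ctx = List Hyp

ctxVars : Ctx → List ℕ
ctxVars []            = []
ctxVars ((P , _) ∷ Γ) = patVars P ++ ctxVars Γ

Distinct : Ctx → Set
Distinct Γ = Unique (ctxVars Γ)

hv : (ℕ × Ty) → Hyp
hv (x , A) = pvar x , A

hv! : (ℕ × Ty) → Hyp
hv! (x , A) = pvar x , !ₜ A

hv§ : (ℕ × Ty) → Hyp
hv§ (x , A) = pvar x , §ₜ A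

sub! : (ℕ × Ty) → ℕ × Tm
sub! (x , _) = x , unbang (var x)

sub§ : (ℕ × Ty) → ℕ × Tm
sub§ (x , _) = x , unpara (var x)

shiftHyp : Hyp → Hyp
shiftHyp (P , A) = P , shiftTy 0 A

infix 3 _⊢_∶_
data _⊢_∶_ : Ctx → Tm → Ty → Set where
  ax     : ∀ x B → [ (pvar x , B) ] ⊢ var x ∶ B
  exch   : ∀ {Γ Δ M A} → Γ ↭ Δ → Γ ⊢ M ∶ A → Δ ⊢ M ∶ A
  cut    : ∀ {Γ Δ M N A B} x → Distinct (Γ ++ Δ) →
           Γ ⊢ M ∶ A → (pvar x , A) ∷ Δ ⊢ N ∶ B →
           Γ ++ Δ ⊢ sub [ (x , M) ] N ∶ B
  weak   : ∀ {Γ M A B} x → Distinct ((pvar x , A) ∷ Γ) →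
           Γ ⊢ M ∶ B → (pvar x , A) ∷ Γ ⊢ M ∶ B
  contr  : ∀ {Γ M A B} x y z → Distinct ((pvar z , !ₜ A) ∷ Γ) →
           (pvar x , !ₜ A) ∷ (pvar y , !ₜ A) ∷ Γ ⊢ M ∶ B →
           (pvar z , !ₜ A) ∷ Γ ⊢ sub ((x , var z) ∷ (y , var z) ∷ []) M ∶ B
  ⊸l     : ∀ {Γ Δ M N A B C} x y → Distinct ((pvar x , A ⊸ B) ∷ Γ ++ Δ) →
           Γ ⊢ M ∶ A → (pvar y , B) ∷ Δ ⊢ N ∶ C →
           (pvar x , A ⊸ B) ∷ Γ ++ Δ ⊢ sub [ (y , app (var x) M) ] N ∶ C
  ⊸r     : ∀ {Γ P M A B} → (P , A) ∷ Γ ⊢ M ∶ B → Γ ⊢ lam P M ∶ A ⊸ B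
  ⊗l     : ∀ {Γ M B B₁ B₂} x₁ x₂ →
           (pvar x₁ , B₁) ∷ (pvar x₂ , B₂) ∷ Γ ⊢ M ∶ B →
           (ptens (pvar x₁) (pvar x₂) , B₁ ⊗ₜ B₂) ∷ Γ ⊢ M ∶ B
  ⊗r     : ∀ {Γ Δ M N A B} → Distinct (Γ ++ Δ) →
           Γ ⊢ M ∶ B → Δ ⊢ N ∶ A → Γ ++ Δ ⊢ tens M N ∶ B ⊗ₜ A
  !₀     : ∀ {M B} → [] ⊢ M ∶ B → [] ⊢ bang M ∶ !ₜ B
  !₁     : ∀ {M A B} x → [ (pvar x , A) ] ⊢ M ∶ B →
           [ (pvar x , !ₜ A) ] ⊢ bang (sub [ (x , unbang (var x)) ] M) ∶ !ₜ B
  §r     : ∀ {M B} (bs as : List (ℕ × Ty)) →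
           map hv bs ++ map hv as ⊢ M ∶ B →
           map hv! bs ++ map hv§ as ⊢ para (sub (map sub! bs ++ map sub§ as) M) ∶ §ₜ B
  ∀l     : ∀ {Γ M A B C} x → (pvar x , substTy 0 B A) ∷ Γ ⊢ M ∶ C →
           (pvar x , ∀ₜ A) ∷ Γ ⊢ M ∶ C
  ∀r     : ∀ {Γ M A} → map shiftHyp Γ ⊢ M ∶ A → Γ ⊢ M ∶ ∀ₜ A

Derivable : Tm → Ty → Set
Derivable M A = Σ Tm λ M' → (M' =α M) × ([] ⊢ M' ∶ A)

-- Polynomials with natural coefficients: coefficient lists a₀ ∷ a₁ ∷ …
-- with non-zero last coefficient (the zero polynomial is [])

Normal : List ℕ → Set
Normal []           = ⊤
Normal (a ∷ [])     = ¬ (a ≡ 0)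
Normal (_ ∷ b ∷ as) = Normal (b ∷ as)

Poly : Set
Poly = Σ (List ℕ) Normal

evalL : List ℕ → ℕ → ℕ
evalL []       n = 0
evalL (a ∷ as) n = a + n * evalL as n

evalP : Poly → ℕ → ℕ
evalP p n = evalL (proj₁ p) n

-- ϑ : maximal index with non-null coefficient (0 for the zero polynomial)
degree : Poly → ℕ
degree p = pred (length (proj₁ p))

-- p̂ follows Horner's scheme.  It turns its argument n̄ into a §-boxed tuple of ϑ copies !n̄
-- (the only way to use n several times in ILAL), starts the accumulator at the leading
-- coefficient and folds h ↦ b + h·n over the remaining ones with terms for addition,
-- multiplication and §-lifting; every fold step costs one §.  Reductions are computed up to
-- the equality of nameless (de Bruijn level) representations, which implies α-equivalence on
-- terms without pattern binders.  For the converse of (b), confluence is replaced by a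
-- relational model: it is sound for reduction and, by continuity, for β-expansion of terms
-- without pattern binders, and it separates numerals by a single token, so p̂ n̄ reduces to
-- §^{ϑ+3} m̄ only for m = p(n).

module Submission where

open import Defs
open import Data.Nat using (ℕ; zero; suc; _+_; _*_; _≡ᵇ_; _≤_; _<_; s≤s; pred; _≟_)
open import Data.Bool using (true; false; if_then_else_; T)
open import Data.Empty using (⊥; ⊥-elim)
open import Data.List using (List; []; _∷_; _++_; [_]; map; length; reverse; _∷ʳ_)
open import Data.List.Membership.Propositional using (_∈_)
open import Data.List.Membership.DecPropositional _≟_ using (_∈?_)
open import Data.List.Membership.Propositional.Properties using (∈-++⁺ˡ; ∈-++⁺ʳ)
open import Data.List.Relation.Unary.All as All using (All; []; _∷_)
open import Data.List.Relation.Unary.All.Properties using (++⁺)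
open import Data.List.Relation.Unary.AllPairs using ([]; _∷_)
open import Data.List.Relation.Unary.Any using (here; there)
open import Data.List.Relation.Unary.Unique.Propositional using (Unique)
open import Data.List.Relation.Unary.Unique.DecPropositional _≟_ using (unique?)
open import Data.List.Relation.Binary.Permutation.Propositional using (_↭_; prep; swap; ↭-refl; ↭-trans)
open import Data.List.Relation.Binary.Permutation.Propositional.Properties using (shift)
open import Data.List.Properties using (++-assoc; ++-identityʳ; unfold-reverse; length-reverse)
open import Data.Nat.Properties
  using (≡ᵇ⇒≡; m≤m⊔n; m≤n⊔m; ≤-trans; <-irrefl; ≤-refl; m≤m+n; m≤n+m; <⇒≤; ≤∧≢⇒<; +-suc; +-identityʳ; *-comm)
open import Data.Product using (Σ; _×_; _,_; proj₁; proj₂)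
open import Data.Sum as Sum using (_⊎_; inj₁; inj₂)
open import Data.Unit using (⊤; tt)
open import Function using (case_of_)
open import Function.Bundles using (_⇔_; mk⇔)
open import Relation.Binary.Construct.Closure.ReflexiveTransitive using (Star; ε; _◅_; _◅◅_; gmap)
open import Relation.Binary.PropositionalEquality hiding ([_])
open import Relation.Nullary using (Dec; yes; no)
open import Relation.Nullary.Decidable using (True; _×-dec_; toWitness)

≡ᵇ-refl : ∀ n → (n ≡ᵇ n) ≡ true
≡ᵇ-refl zero    = refl
≡ᵇ-refl (suc n) = ≡ᵇ-refl n

≡ᵇ≡true⇒≡ : ∀ {m n} → (m ≡ᵇ n) ≡ true → m ≡ n
≡ᵇ≡true⇒≡ {m} {n} eq = ≡ᵇ⇒≡ m n (subst T (sym eq) tt)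

≢⇒≡ᵇ≡false : ∀ {m n} → m ≢ n → (m ≡ᵇ n) ≡ false
≢⇒≡ᵇ≡false {m} {n} m≢n with m ≡ᵇ n in eq
... | true  = ⊥-elim (m≢n (≡ᵇ≡true⇒≡ eq))
... | false = refl

∈⇒≤maxL : ∀ {u xs} → u ∈ xs → u ≤ maxL xs
∈⇒≤maxL {xs = x ∷ xs} (here refl) = m≤m⊔n x (maxL xs)
∈⇒≤maxL {xs = x ∷ xs} (there u∈xs) = ≤-trans (∈⇒≤maxL u∈xs) (m≤n⊔m x (maxL xs))

∈⇒≢suc-maxL : ∀ {u xs} → u ∈ xs → u ≢ suc (maxL xs)
∈⇒≢suc-maxL u∈xs refl = <-irrefl refl (s≤s (∈⇒≤maxL u∈xs))

-- Nameless terms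

-- Bound variables are de Bruijn levels.  A λ over a tensor pattern is collapsed to
-- dpat: the translation is faithful only on Simple terms (defined below).
data Nameless : Set where
  dfree   : ℕ → Nameless
  dbound  : ℕ → Nameless
  dlam    : Nameless → Nameless
  dpat    : Nameless
  dapp    : Nameless → Nameless → Nameless
  dtens   : Nameless → Nameless → Nameless
  dbang   : Nameless → Nameless
  dunbang : Nameless → Nameless
  dpara   : Nameless → Nameless
  dunpara : Nameless → Nameless

-- An environment gives each name a meaning at every binding depth.
Env : Set
Env = ℕ → ℕ → Nameless

extend : Env → ℕ → (ℕ → Nameless) → Env
extend ρ x v u = if u ≡ᵇ x then v else ρ u

bindAt : ℕ → ℕ → Nameless
bindAt d _ = dbound d

nameless : ℕ → Env → Tm → Nameless
nameless d ρ (var x)             = ρ x d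
nameless d ρ (lam (pvar x) M)    = dlam (nameless (suc d) (extend ρ x (bindAt d)) M)
nameless d ρ (lam (ptens _ _) M) = dpat
nameless d ρ (app M N)           = dapp (nameless d ρ M) (nameless d ρ N)
nameless d ρ (tens M N)          = dtens (nameless d ρ M) (nameless d ρ N)
nameless d ρ (bang M)            = dbang (nameless d ρ M)
nameless d ρ (unbang M)          = dunbang (nameless d ρ M)
nameless d ρ (para M)            = dpara (nameless d ρ M)
nameless d ρ (unpara M)          = dunpara (nameless d ρ M)

freeEnv : Env
freeEnv u _ = dfree u

EnvAgreeOn : Tm → Env → Env → Set
EnvAgreeOn M ρ ρ′ = ∀ u → u ∈ allVars M → ∀ d → ρ u d ≡ ρ′ u d

nameless-agree : ∀ d ρ ρ′ M → EnvAgreeOn M ρ ρ′ → nameless d ρ M ≡ nameless d ρ′ M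
nameless-agree d ρ ρ′ (var x) h = h x (here refl) d
nameless-agree d ρ ρ′ (lam (pvar x) M) h = cong dlam (nameless-agree (suc d) _ _ M h′)
  where
  h′ : EnvAgreeOn M (extend ρ x (bindAt d)) (extend ρ′ x (bindAt d))
  h′ u u∈M d′ with u ≡ᵇ x
  ... | true  = refl
  ... | false = h u (there u∈M) d′
nameless-agree d ρ ρ′ (lam (ptens _ _) M) h = refl
nameless-agree d ρ ρ′ (app M N) h =
  cong₂ dapp (nameless-agree d ρ ρ′ M (λ u m → h u (∈-++⁺ˡ m)))
             (nameless-agree d ρ ρ′ N (λ u m → h u (∈-++⁺ʳ (allVars M) m)))
nameless-agree d ρ ρ′ (tens M N) h =
  cong₂ dtens (nameless-agree d ρ ρ′ M (λ u m → h u (∈-++⁺ˡ m)))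
              (nameless-agree d ρ ρ′ N (λ u m → h u (∈-++⁺ʳ (allVars M) m)))
nameless-agree d ρ ρ′ (bang M)   h = cong dbang (nameless-agree d ρ ρ′ M h)
nameless-agree d ρ ρ′ (unbang M) h = cong dunbang (nameless-agree d ρ ρ′ M h)
nameless-agree d ρ ρ′ (para M)   h = cong dpara (nameless-agree d ρ ρ′ M h)
nameless-agree d ρ ρ′ (unpara M) h = cong dunpara (nameless-agree d ρ ρ′ M h)

nameless-ext : ∀ d ρ ρ′ M → (∀ u d′ → ρ u d′ ≡ ρ′ u d′) → nameless d ρ M ≡ nameless d ρ′ M
nameless-ext d ρ ρ′ M h = nameless-agree d ρ ρ′ M (λ u _ → h u)

lookupS-vars : ∀ σ u {v} → v ∈ allVars (lookupS σ u) → v ∈ (u ∷ subVars σ)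
lookupS-vars [] u (here refl) = here refl
lookupS-vars ((y , t) ∷ σ) u v∈ with u ≡ᵇ y
... | true = there (there (∈-++⁺ˡ v∈))
... | false with lookupS-vars σ u v∈
...   | here eq = here eq
...   | there v∈σ = there (there (∈-++⁺ʳ (allVars t) v∈σ))

subEnv : Sub → Env → Env
subEnv σ ρ u d = nameless d ρ (lookupS σ u)

nameless-sub : ∀ d ρ σ M → nameless d ρ (sub σ M) ≡ nameless d (subEnv σ ρ) M
nameless-sub d ρ σ (var x) = refl
nameless-sub d ρ σ (lam (pvar x) M) =
  cong dlam (trans (nameless-sub (suc d) _ _ M) (nameless-agree (suc d) _ _ M fresh-agree))
  where
  L  = x ∷ (allVars M ++ subVars σ)
  x′ = suc (maxL L)
  fresh-agree : EnvAgreeOn M (subEnv ((x , var x′) ∷ σ) (extend ρ x′ (bindAt d)))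
                             (extend (subEnv σ ρ) x (bindAt d))
  fresh-agree u u∈M d′ with u ≡ᵇ x
  ... | true rewrite ≡ᵇ-refl x′ = refl
  ... | false = nameless-agree d′ _ _ (lookupS σ u) x′-unused
    where
    x′-unused : EnvAgreeOn (lookupS σ u) (extend ρ x′ (bindAt d)) ρ
    x′-unused v v∈ d″ with lookupS-vars σ u v∈
    ... | here refl rewrite ≢⇒≡ᵇ≡false (∈⇒≢suc-maxL {xs = L} (there (∈-++⁺ˡ u∈M))) = refl
    ... | there v∈σ
      rewrite ≢⇒≡ᵇ≡false (∈⇒≢suc-maxL {xs = L} (there (∈-++⁺ʳ (allVars M) v∈σ))) = refl
nameless-sub d ρ σ (lam (ptens _ _) M) = refl
nameless-sub d ρ σ (app M N)  = cong₂ dapp (nameless-sub d ρ σ M) (nameless-sub d ρ σ N)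
nameless-sub d ρ σ (tens M N) = cong₂ dtens (nameless-sub d ρ σ M) (nameless-sub d ρ σ N)
nameless-sub d ρ σ (bang M)   = cong dbang (nameless-sub d ρ σ M)
nameless-sub d ρ σ (unbang M) = cong dunbang (nameless-sub d ρ σ M)
nameless-sub d ρ σ (para M)   = cong dpara (nameless-sub d ρ σ M)
nameless-sub d ρ σ (unpara M) = cong dunpara (nameless-sub d ρ σ M)

-- Level 0 becomes the free name z and the other levels move down: this opens a binder.
lowerWith : ℕ → Nameless → Nameless
lowerWith z (dfree u)        = dfree u
lowerWith z (dbound zero)    = dfree z
lowerWith z (dbound (suc k)) = dbound k
lowerWith z (dlam t)         = dlam (lowerWith z t)
lowerWith z dpat             = dpat
lowerWith z (dapp t s)       = dapp (lowerWith z t) (lowerWith z s)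
lowerWith z (dtens t s)      = dtens (lowerWith z t) (lowerWith z s)
lowerWith z (dbang t)        = dbang (lowerWith z t)
lowerWith z (dunbang t)      = dunbang (lowerWith z t)
lowerWith z (dpara t)        = dpara (lowerWith z t)
lowerWith z (dunpara t)      = dunpara (lowerWith z t)

lowerEnv : ℕ → Env → Env
lowerEnv z ρ u d = lowerWith z (ρ u (suc d))

lowerWith-nameless : ∀ z d ρ M →
  lowerWith z (nameless (suc d) ρ M) ≡ nameless d (lowerEnv z ρ) M
lowerWith-nameless z d ρ (var x) = refl
lowerWith-nameless z d ρ (lam (pvar x) M) =
  cong dlam (trans (lowerWith-nameless z (suc d) _ M) (nameless-ext (suc d) _ _ M lower-extend))
  where
  lower-extend : ∀ u d′ → lowerEnv z (extend ρ x (bindAt (suc d))) u d′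
                        ≡ extend (lowerEnv z ρ) x (bindAt d) u d′
  lower-extend u d′ with u ≡ᵇ x
  ... | true  = refl
  ... | false = refl
lowerWith-nameless z d ρ (lam (ptens _ _) M) = refl
lowerWith-nameless z d ρ (app M N) = cong₂ dapp (lowerWith-nameless z d ρ M) (lowerWith-nameless z d ρ N)
lowerWith-nameless z d ρ (tens M N) = cong₂ dtens (lowerWith-nameless z d ρ M) (lowerWith-nameless z d ρ N)
lowerWith-nameless z d ρ (bang M)   = cong dbang (lowerWith-nameless z d ρ M)
lowerWith-nameless z d ρ (unbang M) = cong dunbang (lowerWith-nameless z d ρ M)
lowerWith-nameless z d ρ (para M)   = cong dpara (lowerWith-nameless z d ρ M)
lowerWith-nameless z d ρ (unpara M) = cong dunpara (lowerWith-nameless z d ρ M)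

namelessBody : ℕ → Tm → Nameless
namelessBody x M = nameless 1 (extend freeEnv x (bindAt 0)) M

rename≡lowerWith : ∀ x z M → nameless 0 freeEnv (sub [ (x , var z) ] M) ≡ lowerWith z (namelessBody x M)
rename≡lowerWith x z M =
  trans (nameless-sub 0 freeEnv _ M)
        (trans (nameless-ext 0 _ _ M rename-env) (sym (lowerWith-nameless z 0 _ M)))
  where
  rename-env : ∀ u d → subEnv [ (x , var z) ] freeEnv u d ≡ lowerEnv z (extend freeEnv x (bindAt 0)) u d
  rename-env u d with u ≡ᵇ x
  ... | true  = refl
  ... | false = refl

Simple : Tm → Set
Simple (var _)             = ⊤
Simple (lam (pvar _) M)    = Simple M
Simple (lam (ptens _ _) M) = ⊥
Simple (app M N)           = Simple M × Simple N
Simple (tens M N)          = Simple M × Simple N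
Simple (bang M)            = Simple M
Simple (unbang M)          = Simple M
Simple (para M)            = Simple M
Simple (unpara M)          = Simple M

Simple-sub : ∀ σ M → (∀ u → Simple (lookupS σ u)) → Simple M → Simple (sub σ M)
Simple-sub σ (var x) h s = h x
Simple-sub σ (lam (pvar x) M) h s = Simple-sub _ M h′ s
  where
  h′ : ∀ u → Simple (lookupS ((x , var (suc (maxL (x ∷ (allVars M ++ subVars σ))))) ∷ σ) u)
  h′ u with u ≡ᵇ x
  ... | true  = tt
  ... | false = h u
Simple-sub σ (app M N)  h (s , s′) = Simple-sub σ M h s , Simple-sub σ N h s′
Simple-sub σ (tens M N) h (s , s′) = Simple-sub σ M h s , Simple-sub σ N h s′
Simple-sub σ (bang M)   h s = Simple-sub σ M h s
Simple-sub σ (unbang M) h s = Simple-sub σ M h s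
Simple-sub σ (para M)   h s = Simple-sub σ M h s
Simple-sub σ (unpara M) h s = Simple-sub σ M h s

Simple-rename : ∀ x z M → Simple M → Simple (sub [ (x , var z) ] M)
Simple-rename x z M = Simple-sub _ M var-image
  where
  var-image : ∀ u → Simple (lookupS [ (x , var z) ] u)
  var-image u with u ≡ᵇ x
  ... | true  = tt
  ... | false = tt

size : Tm → ℕ
size (var _)             = 1
size (lam (pvar _) M)    = suc (size M)
size (lam (ptens _ _) M) = 1
size (app M N)           = suc (size M + size N)
size (tens M N)          = suc (size M + size N)
size (bang M)            = suc (size M)
size (unbang M)          = suc (size M)
size (para M)            = suc (size M)
size (unpara M)          = suc (size M)

IsVar : Tm → Set
IsVar t = Σ ℕ λ v → t ≡ var v

size-sub-renaming : ∀ σ M → (∀ u → IsVar (lookupS σ u)) → size (sub σ M) ≡ size M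
size-sub-renaming σ (var x) h with h x
... | v , eq rewrite eq = refl
size-sub-renaming σ (lam (pvar x) M) h = cong suc (size-sub-renaming _ M h′)
  where
  h′ : ∀ u → IsVar (lookupS ((x , var (suc (maxL (x ∷ (allVars M ++ subVars σ))))) ∷ σ) u)
  h′ u with u ≡ᵇ x
  ... | true  = _ , refl
  ... | false = h u
size-sub-renaming σ (lam (ptens _ _) M) h = refl
size-sub-renaming σ (app M N)  h = cong₂ (λ a b → suc (a + b)) (size-sub-renaming σ M h) (size-sub-renaming σ N h)
size-sub-renaming σ (tens M N) h = cong₂ (λ a b → suc (a + b)) (size-sub-renaming σ M h) (size-sub-renaming σ N h)
size-sub-renaming σ (bang M)   h = cong suc (size-sub-renaming σ M h)
size-sub-renaming σ (unbang M) h = cong suc (size-sub-renaming σ M h)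
size-sub-renaming σ (para M)   h = cong suc (size-sub-renaming σ M h)
size-sub-renaming σ (unpara M) h = cong suc (size-sub-renaming σ M h)

size-rename : ∀ x z M → size (sub [ (x , var z) ] M) ≡ size M
size-rename x z M = size-sub-renaming _ M var-image
  where
  var-image : ∀ u → IsVar (lookupS [ (x , var z) ] u)
  var-image u with u ≡ᵇ x
  ... | true  = _ , refl
  ... | false = _ , refl

-- Inversion of the nameless translation at depth 0; matching on the equation first lets
-- the view rule out every constructor mismatch at once.
data NamelessView : Nameless → Tm → Set where
  view-var    : ∀ x → NamelessView (dfree x) (var x)
  view-lam    : ∀ {b} x N → namelessBody x N ≡ b → NamelessView (dlam b) (lam (pvar x) N)
  view-pat    : ∀ P Q N → NamelessView dpat (lam (ptens P Q) N)
  view-app    : ∀ {a b} N N′ → nameless 0 freeEnv N ≡ a → nameless 0 freeEnv N′ ≡ b →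
                NamelessView (dapp a b) (app N N′)
  view-tens   : ∀ {a b} N N′ → nameless 0 freeEnv N ≡ a → nameless 0 freeEnv N′ ≡ b →
                NamelessView (dtens a b) (tens N N′)
  view-bang   : ∀ {a} N → nameless 0 freeEnv N ≡ a → NamelessView (dbang a) (bang N)
  view-unbang : ∀ {a} N → nameless 0 freeEnv N ≡ a → NamelessView (dunbang a) (unbang N)
  view-para   : ∀ {a} N → nameless 0 freeEnv N ≡ a → NamelessView (dpara a) (para N)
  view-unpara : ∀ {a} N → nameless 0 freeEnv N ≡ a → NamelessView (dunpara a) (unpara N)

namelessView : ∀ N → NamelessView (nameless 0 freeEnv N) N
namelessView (var x)             = view-var x
namelessView (lam (pvar x) N)    = view-lam x N refl
namelessView (lam (ptens P Q) N) = view-pat P Q N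
namelessView (app N N′)          = view-app N N′ refl refl
namelessView (tens N N′)         = view-tens N N′ refl refl
namelessView (bang N)            = view-bang N refl
namelessView (unbang N)          = view-unbang N refl
namelessView (para N)            = view-para N refl
namelessView (unpara N)          = view-unpara N refl

<-left : ∀ {a b n} → suc (a + b) < suc n → a < n
<-left {a} {b} (s≤s lt) = ≤-trans (s≤s (m≤m+n a b)) lt

<-right : ∀ {a b n} → suc (a + b) < suc n → b < n
<-right {a} {b} (s≤s lt) = ≤-trans (s≤s (m≤n+m b a)) lt

-- By induction on a size bound, since renaming a binder preserves size.
nameless≡⇒=α : ∀ n M {t} N → size M < n → Simple M → Simple N →
               nameless 0 freeEnv M ≡ t → NamelessView t N → M =α N
nameless≡⇒=α (suc n) (var x) _ _ _ _ refl (view-var x) = α-var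
nameless≡⇒=α (suc n) (lam (pvar x) M) _ (s≤s lt) sM sN refl (view-lam y N eq) =
  α-lam (z ∷ []) sh-var ([] ∷ []) refl ((λ z∈ → ∈⇒≢suc-maxL z∈ refl) ∷ [])
    (nameless≡⇒=α n (sub [ (x , var z) ] M) (sub [ (y , var z) ] N)
      (subst (_< n) (sym (size-rename x z M)) lt)
      (Simple-rename x z M sM) (Simple-rename y z N sN)
      (trans (rename≡lowerWith x z M) (cong (lowerWith z) (sym eq)))
      (subst (λ t → NamelessView t (sub [ (y , var z) ] N)) (rename≡lowerWith y z N)
        (namelessView _)))
  where
  z = suc (maxL (x ∷ y ∷ (allVars M ++ allVars N)))
nameless≡⇒=α (suc n) (app M M′) _ lt (sM , sM′) (sN , sN′) refl (view-app N N′ eq eq′) =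
  α-app (nameless≡⇒=α n M N (<-left lt) sM sN (sym eq) (namelessView N))
        (nameless≡⇒=α n M′ N′ (<-right {size M} lt) sM′ sN′ (sym eq′) (namelessView N′))
nameless≡⇒=α (suc n) (tens M M′) _ lt (sM , sM′) (sN , sN′) refl (view-tens N N′ eq eq′) =
  α-tens (nameless≡⇒=α n M N (<-left lt) sM sN (sym eq) (namelessView N))
         (nameless≡⇒=α n M′ N′ (<-right {size M} lt) sM′ sN′ (sym eq′) (namelessView N′))
nameless≡⇒=α (suc n) (bang M) _ (s≤s lt) sM sN refl (view-bang N eq) =
  α-bang (nameless≡⇒=α n M N lt sM sN (sym eq) (namelessView N))
nameless≡⇒=α (suc n) (unbang M) _ (s≤s lt) sM sN refl (view-unbang N eq) =
  α-unbang (nameless≡⇒=α n M N lt sM sN (sym eq) (namelessView N))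
nameless≡⇒=α (suc n) (para M) _ (s≤s lt) sM sN refl (view-para N eq) =
  α-para (nameless≡⇒=α n M N lt sM sN (sym eq) (namelessView N))
nameless≡⇒=α (suc n) (unpara M) _ (s≤s lt) sM sN refl (view-unpara N eq) =
  α-unpara (nameless≡⇒=α n M N lt sM sN (sym eq) (namelessView N))

-- A relational model

-- A token arr e t belongs to a function that maps every token of the list e into a set
-- containing t.
data Token : Set where
  base : ℕ → Token
  arr  : List Token → Token → Token

Val : Set₁
Val = Token → Set

Valuation : Set₁
Valuation = ℕ → Val

listed : List Token → Val
listed e t = t ∈ e

extendV : Valuation → ℕ → Val → Valuation
extendV γ x X u = if u ≡ᵇ x then X else γ u

⟦_⟧ : Tm → Valuation → Val
⟦ var x ⟧ γ                     = γ x
⟦ lam (pvar x) M ⟧ γ (base _)   = ⊥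
⟦ lam (pvar x) M ⟧ γ (arr e t)  = ⟦ M ⟧ (extendV γ x (listed e)) t
⟦ lam (ptens _ _) M ⟧ γ _       = ⊥
⟦ app M N ⟧ γ t                 = Σ (List Token) λ e → All (⟦ N ⟧ γ) e × ⟦ M ⟧ γ (arr e t)
⟦ tens M N ⟧ γ _                = ⊥
⟦ bang M ⟧ γ                    = ⟦ M ⟧ γ
⟦ unbang M ⟧ γ                  = ⟦ M ⟧ γ
⟦ para M ⟧ γ                    = ⟦ M ⟧ γ
⟦ unpara M ⟧ γ                  = ⟦ M ⟧ γ

infix 4 _⊆_ _≋_

_⊆_ : Val → Val → Set
X ⊆ Y = ∀ {s} → X s → Y s

_≋_ : Val → Val → Set
X ≋ Y = (X ⊆ Y) × (Y ⊆ X)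

≋-refl : ∀ {X} → X ≋ X
≋-refl = (λ x → x) , (λ x → x)

≋-sym : ∀ {X Y} → X ≋ Y → Y ≋ X
≋-sym (f , g) = g , f

≋-trans : ∀ {X Y Z} → X ≋ Y → Y ≋ Z → X ≋ Z
≋-trans (f , g) (f′ , g′) = (λ x → f′ (f x)) , (λ z → g (g′ z))

⟦⟧-mono : ∀ M γ γ′ → (∀ u → u ∈ allVars M → γ u ⊆ γ′ u) → ⟦ M ⟧ γ ⊆ ⟦ M ⟧ γ′
⟦⟧-mono (var x) γ γ′ h p = h x (here refl) p
⟦⟧-mono (lam (pvar x) M) γ γ′ h {arr e t} p = ⟦⟧-mono M _ _ h′ p
  where
  h′ : ∀ u → u ∈ allVars M → extendV γ x (listed e) u ⊆ extendV γ′ x (listed e) u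
  h′ u u∈M with u ≡ᵇ x
  ... | true  = λ q → q
  ... | false = h u (there u∈M)
⟦⟧-mono (app M N) γ γ′ h (e , ps , q) =
  e , All.map (⟦⟧-mono N γ γ′ (λ u m → h u (∈-++⁺ʳ (allVars M) m))) ps ,
  ⟦⟧-mono M γ γ′ (λ u m → h u (∈-++⁺ˡ m)) q
⟦⟧-mono (bang M)   γ γ′ h p = ⟦⟧-mono M γ γ′ h p
⟦⟧-mono (unbang M) γ γ′ h p = ⟦⟧-mono M γ γ′ h p
⟦⟧-mono (para M)   γ γ′ h p = ⟦⟧-mono M γ γ′ h p
⟦⟧-mono (unpara M) γ γ′ h p = ⟦⟧-mono M γ γ′ h p

⟦⟧-agree : ∀ M γ γ′ → (∀ u → u ∈ allVars M → γ u ≋ γ′ u) → ⟦ M ⟧ γ ≋ ⟦ M ⟧ γ′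
⟦⟧-agree M γ γ′ h = ⟦⟧-mono M γ γ′ (λ u m → proj₁ (h u m)) , ⟦⟧-mono M γ′ γ (λ u m → proj₂ (h u m))

⟦lam⟧-cong : ∀ x M y N γ δ → (∀ e → ⟦ M ⟧ (extendV γ x (listed e)) ≋ ⟦ N ⟧ (extendV δ y (listed e))) →
             ⟦ lam (pvar x) M ⟧ γ ≋ ⟦ lam (pvar y) N ⟧ δ
⟦lam⟧-cong x M y N γ δ h =
  (λ { {arr e t} p → proj₁ (h e) p }) , (λ { {arr e t} p → proj₂ (h e) p })

subVal : Sub → Valuation → Valuation
subVal σ γ u = ⟦ lookupS σ u ⟧ γ

⟦⟧-sub : ∀ σ M γ → ⟦ sub σ M ⟧ γ ≋ ⟦ M ⟧ (subVal σ γ)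
⟦⟧-sub σ (var x) γ = ≋-refl
⟦⟧-sub σ (lam (pvar x) M) γ = ⟦lam⟧-cong _ _ _ _ _ _ λ e →
  ≋-trans (⟦⟧-sub _ M _) (⟦⟧-agree M _ _ (fresh-agree e))
  where
  L  = x ∷ (allVars M ++ subVars σ)
  x′ = suc (maxL L)
  fresh-agree : ∀ e u → u ∈ allVars M →
    subVal ((x , var x′) ∷ σ) (extendV γ x′ (listed e)) u ≋ extendV (subVal σ γ) x (listed e) u
  fresh-agree e u u∈M with u ≡ᵇ x
  ... | true rewrite ≡ᵇ-refl x′ = ≋-refl
  ... | false = ⟦⟧-agree (lookupS σ u) _ _ x′-unused
    where
    x′-unused : ∀ v → v ∈ allVars (lookupS σ u) → extendV γ x′ (listed e) v ≋ γ v
    x′-unused v v∈ with lookupS-vars σ u v∈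
    ... | here refl rewrite ≢⇒≡ᵇ≡false (∈⇒≢suc-maxL {xs = L} (there (∈-++⁺ˡ u∈M))) = ≋-refl
    ... | there v∈σ
      rewrite ≢⇒≡ᵇ≡false (∈⇒≢suc-maxL {xs = L} (there (∈-++⁺ʳ (allVars M) v∈σ))) = ≋-refl
⟦⟧-sub σ (lam (ptens _ _) M) γ = (λ ()) , (λ ())
⟦⟧-sub σ (app M N) γ =
  (λ { (e , ps , q) → e , All.map (proj₁ (⟦⟧-sub σ N γ)) ps , proj₁ (⟦⟧-sub σ M γ) q }) ,
  (λ { (e , ps , q) → e , All.map (proj₂ (⟦⟧-sub σ N γ)) ps , proj₂ (⟦⟧-sub σ M γ) q })
⟦⟧-sub σ (tens M N) γ = (λ ()) , (λ ())
⟦⟧-sub σ (bang M)   γ = ⟦⟧-sub σ M γ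
⟦⟧-sub σ (unbang M) γ = ⟦⟧-sub σ M γ
⟦⟧-sub σ (para M)   γ = ⟦⟧-sub σ M γ
⟦⟧-sub σ (unpara M) γ = ⟦⟧-sub σ M γ

⟦⟧-rename : ∀ x z M γ X → z ∉ allVars M →
            ⟦ M ⟧ (extendV γ x X) ≋ ⟦ sub [ (x , var z) ] M ⟧ (extendV γ z X)
⟦⟧-rename x z M γ X z∉M = ≋-trans (⟦⟧-agree M _ _ renamed) (≋-sym (⟦⟧-sub _ M _))
  where
  renamed : ∀ u → u ∈ allVars M → extendV γ x X u ≋ subVal [ (x , var z) ] (extendV γ z X) u
  renamed u u∈M with u ≡ᵇ x
  ... | true rewrite ≡ᵇ-refl z = ≋-refl
  ... | false rewrite ≢⇒≡ᵇ≡false {u} {z} (λ { refl → z∉M u∈M }) = ≋-refl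

⟦⟧-=α : ∀ {M N} → M =α N → ∀ γ → ⟦ M ⟧ γ ≋ ⟦ N ⟧ γ
⟦⟧-=α α-var γ = ≋-refl
⟦⟧-=α (α-lam {pvar x} {pvar y} {M} {N} (z ∷ []) sh-var _ _ (z∉ ∷ []) M≡N) γ =
  ⟦lam⟧-cong _ _ _ _ _ _ λ e →
    ≋-trans (⟦⟧-rename x z M γ (listed e) (λ z∈ → z∉ (there (there (∈-++⁺ˡ z∈)))))
   (≋-trans (⟦⟧-=α M≡N _)
            (≋-sym (⟦⟧-rename y z N γ (listed e) (λ z∈ → z∉ (there (there (∈-++⁺ʳ (allVars M) z∈)))))))
⟦⟧-=α (α-lam {ptens _ _} {ptens _ _} _ (sh-tens _ _) _ _ _ _) γ = (λ ()) , (λ ())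
⟦⟧-=α (α-app M≡M′ N≡N′) γ =
  (λ { (e , ps , q) → e , All.map (proj₁ (⟦⟧-=α N≡N′ γ)) ps , proj₁ (⟦⟧-=α M≡M′ γ) q }) ,
  (λ { (e , ps , q) → e , All.map (proj₂ (⟦⟧-=α N≡N′ γ)) ps , proj₂ (⟦⟧-=α M≡M′ γ) q })
⟦⟧-=α (α-tens _ _) γ = (λ ()) , (λ ())
⟦⟧-=α (α-bang M≡N)   γ = ⟦⟧-=α M≡N γ
⟦⟧-=α (α-unbang M≡N) γ = ⟦⟧-=α M≡N γ
⟦⟧-=α (α-para M≡N)   γ = ⟦⟧-=α M≡N γ
⟦⟧-=α (α-unpara M≡N) γ = ⟦⟧-=α M≡N γ

β-valuation : ∀ x N γ e → All (⟦ N ⟧ γ) e →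
              ∀ u → extendV γ x (listed e) u ⊆ subVal [ (x , N) ] γ u
β-valuation x N γ e ps u with u ≡ᵇ x
... | true  = All.lookup ps
... | false = λ q → q

⟦⟧-β : ∀ x M N γ → ⟦ app (lam (pvar x) M) N ⟧ γ ⊆ ⟦ sub [ (x , N) ] M ⟧ γ
⟦⟧-β x M N γ (e , ps , q) =
  proj₂ (⟦⟧-sub _ M γ) (⟦⟧-mono M _ _ (λ u _ → β-valuation x N γ e ps u) q)

⟦⟧-⇝ : ∀ {M N} → M ⇝ N → ∀ γ → ⟦ M ⟧ γ ⊆ ⟦ N ⟧ γ
⟦⟧-⇝ (β {pvar x} {M} {N} refl) γ p = ⟦⟧-β x M N γ p
⟦⟧-⇝ (β {ptens _ _} eq) γ (_ , _ , ())
⟦⟧-⇝ β! γ p = p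
⟦⟧-⇝ β§ γ p = p
⟦⟧-⇝ (c-lam {pvar x} r) γ {arr e t} p = ⟦⟧-⇝ r _ p
⟦⟧-⇝ (c-appl r) γ (e , ps , q) = e , ps , ⟦⟧-⇝ r γ q
⟦⟧-⇝ (c-appr r) γ (e , ps , q) = e , All.map (⟦⟧-⇝ r γ) ps , q
⟦⟧-⇝ (c-bang r)   γ p = ⟦⟧-⇝ r γ p
⟦⟧-⇝ (c-unbang r) γ p = ⟦⟧-⇝ r γ p
⟦⟧-⇝ (c-para r)   γ p = ⟦⟧-⇝ r γ p
⟦⟧-⇝ (c-unpara r) γ p = ⟦⟧-⇝ r γ p

⟦⟧-⇝* : ∀ {M N} → M ⇝* N → ∀ γ → ⟦ M ⟧ γ ⊆ ⟦ N ⟧ γ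
⟦⟧-⇝* ε γ p = p
⟦⟧-⇝* (inj₁ r ◅ rs) γ p = ⟦⟧-⇝* rs γ (⟦⟧-⇝ r γ p)
⟦⟧-⇝* (inj₂ α ◅ rs) γ p = ⟦⟧-⇝* rs γ (proj₁ (⟦⟧-=α α γ) p)

FinValuation : Set
FinValuation = ℕ → List Token

listedV : FinValuation → Valuation
listedV E u = listed (E u)

_∪_ : FinValuation → FinValuation → FinValuation
(E ∪ E′) u = E u ++ E′ u

Below : Valuation → FinValuation → Set
Below γ E = ∀ u → All (γ u) (E u)

∪-Below : ∀ {γ E E′} → Below γ E → Below γ E′ → Below γ (E ∪ E′)
∪-Below below below′ u = ++⁺ (below u) (below′ u)

⟦⟧-∪ˡ : ∀ M E E′ → ⟦ M ⟧ (listedV E) ⊆ ⟦ M ⟧ (listedV (E ∪ E′))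
⟦⟧-∪ˡ M E E′ = ⟦⟧-mono M _ _ (λ u _ → ∈-++⁺ˡ)

⟦⟧-∪ʳ : ∀ M E E′ → ⟦ M ⟧ (listedV E′) ⊆ ⟦ M ⟧ (listedV (E ∪ E′))
⟦⟧-∪ʳ M E E′ = ⟦⟧-mono M _ _ (λ u _ → ∈-++⁺ʳ (E u))

mutual
  ⟦⟧-continuous : ∀ M γ {s} → ⟦ M ⟧ γ s → Σ FinValuation λ E → Below γ E × ⟦ M ⟧ (listedV E) s
  ⟦⟧-continuous (var x) γ {s} p = E , below , s∈Ex
    where
    E : FinValuation
    E u = if u ≡ᵇ x then [ s ] else []
    below : Below γ E
    below u with u ≡ᵇ x in eq
    ... | true  = subst (λ w → γ w s) (sym (≡ᵇ≡true⇒≡ eq)) p ∷ []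
    ... | false = []
    s∈Ex : listed (E x) s
    s∈Ex rewrite ≡ᵇ-refl x = here refl
  ⟦⟧-continuous (lam (pvar x) M) γ {arr e t} p with ⟦⟧-continuous M _ p
  ... | E′ , below′ , q = E , below , ⟦⟧-mono M (listedV E′) _ (λ u _ → reassemble u) q
    where
    E : FinValuation
    E u = if u ≡ᵇ x then [] else E′ u
    below : Below γ E
    below u with u ≡ᵇ x | below′ u
    ... | true  | _ = []
    ... | false | b = b
    reassemble : ∀ u → listed (E′ u) ⊆ extendV (listedV E) x (listed e) u
    reassemble u m with u ≡ᵇ x | below′ u
    ... | true  | b = All.lookup b m
    ... | false | _ = m
  ⟦⟧-continuous (app M N) γ (e , ps , q) with ⟦⟧-continuous M γ q | ⟦⟧-continuousAll N γ ps
  ... | E₀ , below₀ , q₀ | E₁ , below₁ , qs₁ =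
    E₀ ∪ E₁ , ∪-Below below₀ below₁ , e , All.map (⟦⟧-∪ʳ N E₀ E₁) qs₁ , ⟦⟧-∪ˡ M E₀ E₁ q₀
  ⟦⟧-continuous (bang M)   γ p = ⟦⟧-continuous M γ p
  ⟦⟧-continuous (unbang M) γ p = ⟦⟧-continuous M γ p
  ⟦⟧-continuous (para M)   γ p = ⟦⟧-continuous M γ p
  ⟦⟧-continuous (unpara M) γ p = ⟦⟧-continuous M γ p

  ⟦⟧-continuousAll : ∀ N γ {e} → All (⟦ N ⟧ γ) e →
                     Σ FinValuation λ E → Below γ E × All (⟦ N ⟧ (listedV E)) e
  ⟦⟧-continuousAll N γ [] = (λ _ → []) , (λ u → []) , []
  ⟦⟧-continuousAll N γ (p ∷ ps) with ⟦⟧-continuous N γ p | ⟦⟧-continuousAll N γ ps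
  ... | E₀ , below₀ , q₀ | E₁ , below₁ , qs₁ =
    E₀ ∪ E₁ , ∪-Below below₀ below₁ , ⟦⟧-∪ˡ N E₀ E₁ q₀ ∷ All.map (⟦⟧-∪ʳ N E₀ E₁) qs₁

-- By continuity the body uses only a finite list E x of tokens of the argument.
⟦⟧-β-expand : ∀ x M N γ → ⟦ sub [ (x , N) ] M ⟧ γ ⊆ ⟦ app (lam (pvar x) M) N ⟧ γ
⟦⟧-β-expand x M N γ p with ⟦⟧-continuous M _ (proj₁ (⟦⟧-sub [ (x , N) ] M γ) p)
... | E , below , q = E x , argument-tokens , ⟦⟧-mono M (listedV E) _ (λ u _ → recover u) q
  where
  argument-tokens : All (⟦ N ⟧ γ) (E x)
  argument-tokens with below x
  ... | b rewrite ≡ᵇ-refl x = b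
  recover : ∀ u → listed (E u) ⊆ extendV γ x (listed (E x)) u
  recover u m with u ≡ᵇ x in eq | below u
  ... | true  | _ = subst (λ w → listed (E w) _) (≡ᵇ≡true⇒≡ eq) m
  ... | false | b = All.lookup b m

Simple-β : ∀ x M N → Simple M → Simple N → Simple (sub [ (x , N) ] M)
Simple-β x M N sM sN = Simple-sub _ M argument sM
  where
  argument : ∀ u → Simple (lookupS [ (x , N) ] u)
  argument u with u ≡ᵇ x
  ... | true  = sN
  ... | false = tt

Simple-⇝ : ∀ {M N} → Simple M → M ⇝ N → Simple N
Simple-⇝ {app (lam (pvar x) M) N} (sM , sN) (β refl) = Simple-β x M N sM sN
Simple-⇝ s β! = s
Simple-⇝ s β§ = s
Simple-⇝ {lam (pvar x) _} s (c-lam r) = Simple-⇝ s r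
Simple-⇝ (s , s′) (c-appl r)  = Simple-⇝ s r , s′
Simple-⇝ (s , s′) (c-appr r)  = s , Simple-⇝ s′ r
Simple-⇝ (s , s′) (c-tensl r) = Simple-⇝ s r , s′
Simple-⇝ (s , s′) (c-tensr r) = s , Simple-⇝ s′ r
Simple-⇝ s (c-bang r)   = Simple-⇝ s r
Simple-⇝ s (c-unbang r) = Simple-⇝ s r
Simple-⇝ s (c-para r)   = Simple-⇝ s r
Simple-⇝ s (c-unpara r) = Simple-⇝ s r

⟦⟧-⇝-expand : ∀ {M N} → Simple M → M ⇝ N → ∀ γ → ⟦ N ⟧ γ ⊆ ⟦ M ⟧ γ
⟦⟧-⇝-expand {app (lam (pvar x) M) N} _ (β refl) γ p = ⟦⟧-β-expand x M N γ p
⟦⟧-⇝-expand s β! γ p = p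
⟦⟧-⇝-expand s β§ γ p = p
⟦⟧-⇝-expand {lam (pvar x) _} s (c-lam r) γ {arr e t} p = ⟦⟧-⇝-expand s r _ p
⟦⟧-⇝-expand (s , _) (c-appl r) γ (e , ps , q) = e , ps , ⟦⟧-⇝-expand s r γ q
⟦⟧-⇝-expand (_ , s) (c-appr r) γ (e , ps , q) = e , All.map (⟦⟧-⇝-expand s r γ) ps , q
⟦⟧-⇝-expand s (c-bang r)   γ p = ⟦⟧-⇝-expand s r γ p
⟦⟧-⇝-expand s (c-unbang r) γ p = ⟦⟧-⇝-expand s r γ p
⟦⟧-⇝-expand s (c-para r)   γ p = ⟦⟧-⇝-expand s r γ p
⟦⟧-⇝-expand s (c-unpara r) γ p = ⟦⟧-⇝-expand s r γ p

infix 4 _≈_ _↠_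

record _≈_ (M N : Tm) : Set where
  constructor mk≈
  field ≈-nameless : ∀ d ρ → nameless d ρ M ≡ nameless d ρ N
open _≈_

≈-refl : ∀ {M} → M ≈ M
≈-refl = mk≈ λ d ρ → refl

≈-sym : ∀ {M N} → M ≈ N → N ≈ M
≈-sym M≈N = mk≈ λ d ρ → sym (≈-nameless M≈N d ρ)

_↠_ : Tm → Tm → Set
_↠_ = Star (λ M N → (M ⇝ N) ⊎ (M ≈ N))

NoPat : Nameless → Set
NoPat (dfree _)   = ⊤
NoPat (dbound _)  = ⊤
NoPat (dlam t)    = NoPat t
NoPat dpat        = ⊥
NoPat (dapp t s)  = NoPat t × NoPat s
NoPat (dtens t s) = NoPat t × NoPat s
NoPat (dbang t)   = NoPat t
NoPat (dunbang t) = NoPat t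
NoPat (dpara t)   = NoPat t
NoPat (dunpara t) = NoPat t

Simple⇒NoPat : ∀ M d ρ → Simple M → (∀ u d′ → NoPat (ρ u d′)) → NoPat (nameless d ρ M)
Simple⇒NoPat (var x) d ρ s h = h x d
Simple⇒NoPat (lam (pvar x) M) d ρ s h = Simple⇒NoPat M (suc d) _ s h′
  where
  h′ : ∀ u d′ → NoPat (extend ρ x (bindAt d) u d′)
  h′ u d′ with u ≡ᵇ x
  ... | true  = tt
  ... | false = h u d′
Simple⇒NoPat (app M N)  d ρ (s , s′) h = Simple⇒NoPat M d ρ s h , Simple⇒NoPat N d ρ s′ h
Simple⇒NoPat (tens M N) d ρ (s , s′) h = Simple⇒NoPat M d ρ s h , Simple⇒NoPat N d ρ s′ h
Simple⇒NoPat (bang M)   d ρ s h = Simple⇒NoPat M d ρ s h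
Simple⇒NoPat (unbang M) d ρ s h = Simple⇒NoPat M d ρ s h
Simple⇒NoPat (para M)   d ρ s h = Simple⇒NoPat M d ρ s h
Simple⇒NoPat (unpara M) d ρ s h = Simple⇒NoPat M d ρ s h

NoPat⇒Simple : ∀ M d ρ → NoPat (nameless d ρ M) → Simple M
NoPat⇒Simple (var x) d ρ np = tt
NoPat⇒Simple (lam (pvar x) M) d ρ np = NoPat⇒Simple M _ _ np
NoPat⇒Simple (app M N)  d ρ (np , np′) = NoPat⇒Simple M d ρ np , NoPat⇒Simple N d ρ np′
NoPat⇒Simple (tens M N) d ρ (np , np′) = NoPat⇒Simple M d ρ np , NoPat⇒Simple N d ρ np′
NoPat⇒Simple (bang M)   d ρ np = NoPat⇒Simple M d ρ np
NoPat⇒Simple (unbang M) d ρ np = NoPat⇒Simple M d ρ np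
NoPat⇒Simple (para M)   d ρ np = NoPat⇒Simple M d ρ np
NoPat⇒Simple (unpara M) d ρ np = NoPat⇒Simple M d ρ np

Simple-≈ : ∀ {M N} → Simple M → M ≈ N → Simple N
Simple-≈ {M} {N} s M≈N =
  NoPat⇒Simple N 0 freeEnv
    (subst NoPat (≈-nameless M≈N 0 freeEnv) (Simple⇒NoPat M 0 freeEnv s (λ _ _ → tt)))

≈⇒=α : ∀ {M N} → Simple M → M ≈ N → M =α N
≈⇒=α {M} {N} s M≈N =
  nameless≡⇒=α (suc (size M)) M N ≤-refl s (Simple-≈ s M≈N) (≈-nameless M≈N 0 freeEnv) (namelessView N)

↠⇒⇝* : ∀ {M N} → Simple M → M ↠ N → M ⇝* N
↠⇒⇝* s ε = ε
↠⇒⇝* s (inj₁ r ◅ rs) = inj₁ r ◅ ↠⇒⇝* (Simple-⇝ s r) rs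
↠⇒⇝* s (inj₂ e ◅ rs) = inj₂ (≈⇒=α s e) ◅ ↠⇒⇝* (Simple-≈ s e) rs

⟦⟧-↠-expand : ∀ {M N} → Simple M → M ↠ N → ∀ γ → ⟦ N ⟧ γ ⊆ ⟦ M ⟧ γ
⟦⟧-↠-expand s ε γ p = p
⟦⟧-↠-expand s (inj₁ r ◅ rs) γ p = ⟦⟧-⇝-expand s r γ (⟦⟧-↠-expand (Simple-⇝ s r) rs γ p)
⟦⟧-↠-expand s (inj₂ e ◅ rs) γ p =
  proj₂ (⟦⟧-=α (≈⇒=α s e) γ) (⟦⟧-↠-expand (Simple-≈ s e) rs γ p)

-- Numerals in the model: n̄ is characterised by the token in which !x is the successor
-- relation on base 0, …, base n and y is base 0.
successors : ℕ → List Token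
successors zero    = []
successors (suc m) = arr [ base m ] (base (suc m)) ∷ successors m

numeralToken : ℕ → Token
numeralToken m = arr (successors m) (arr [ base 0 ] (base m))

∈-successors⁻ : ∀ {m e j} → arr e (base j) ∈ successors m →
                Σ ℕ λ k → (e ≡ [ base k ]) × (j ≡ suc k)
∈-successors⁻ {suc m} (here refl) = m , refl , refl
∈-successors⁻ {suc m} (there p)   = ∈-successors⁻ p

∈-successors⁺ : ∀ {k m} → k < m → arr [ base k ] (base (suc k)) ∈ successors m
∈-successors⁺ {k} {suc m} (s≤s k≤m) with k ≟ m
... | yes refl = here refl
... | no k≢m   = there (∈-successors⁺ (≤∧≢⇒< k≤m k≢m))

base-injective : ∀ {a b} → base a ≡ base b → a ≡ b
base-injective refl = refl

⟦iterX⟧⁻ : ∀ m γ m′ j → (γ 0 ⊆ listed (successors m′)) → (γ 1 ⊆ listed [ base 0 ]) →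
           ⟦ iterX m ⟧ γ (base j) → j ≡ m
⟦iterX⟧⁻ zero γ m′ j h₀ h₁ p with h₁ p
... | here eq = base-injective eq
⟦iterX⟧⁻ (suc m) γ m′ j h₀ h₁ (e , ps , q) with ∈-successors⁻ (h₀ q)
... | k , refl , refl with ps
...   | pk ∷ [] = cong suc (⟦iterX⟧⁻ m γ m′ k h₀ h₁ pk)

⟦iterX⟧⁺ : ∀ m γ m′ → (listed (successors m′) ⊆ γ 0) → γ 1 (base 0) → m ≤ m′ →
           ⟦ iterX m ⟧ γ (base m)
⟦iterX⟧⁺ zero    γ m′ h₀ h₁ m≤m′ = h₁
⟦iterX⟧⁺ (suc m) γ m′ h₀ h₁ m<m′ =
  [ base m ] , ⟦iterX⟧⁺ m γ m′ h₀ h₁ (<⇒≤ m<m′) ∷ [] , h₀ (∈-successors⁺ m<m′)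

numeralToken∈⟦num⟧ : ∀ m γ → ⟦ num m ⟧ γ (numeralToken m)
numeralToken∈⟦num⟧ m γ = ⟦iterX⟧⁺ m _ m (λ p → p) (here refl) ≤-refl

numeralToken∈⟦num⟧⁻ : ∀ m m′ γ → ⟦ num m ⟧ γ (numeralToken m′) → m′ ≡ m
numeralToken∈⟦num⟧⁻ m m′ γ p = ⟦iterX⟧⁻ m _ m′ m′ (λ p → p) (λ p → p) p

⟦paraⁿ⟧ : ∀ k M γ → ⟦ paraⁿ k M ⟧ γ ≋ ⟦ M ⟧ γ
⟦paraⁿ⟧ zero    M γ = ≋-refl
⟦paraⁿ⟧ (suc k) M γ = ⟦paraⁿ⟧ k M γ

-- Replaces confluence: the chain to §ᵏ v̄ can be run backwards in the model.
↠-numeral-unique : ∀ {M} k v m → Simple M → M ↠ paraⁿ k (num v) → M ⇝* paraⁿ k (num m) → v ≡ m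
↠-numeral-unique k v m s M↠v M⇝*m =
  numeralToken∈⟦num⟧⁻ m v γ
    (proj₁ (⟦paraⁿ⟧ k (num m) γ) {numeralToken v} (⟦⟧-⇝* M⇝*m γ
      (⟦⟧-↠-expand s M↠v γ (proj₂ (⟦paraⁿ⟧ k (num v) γ) {numeralToken v} (numeralToken∈⟦num⟧ v γ)))))
  where
  γ : Valuation
  γ _ _ = ⊥

plainSub : ℕ → Tm → Tm → Tm
plainSub x N (var y)             = if y ≡ᵇ x then N else var y
plainSub x N (lam (pvar y) M)    = if y ≡ᵇ x then lam (pvar y) M else lam (pvar y) (plainSub x N M)
plainSub x N (lam (ptens P Q) M) = lam (ptens P Q) M
plainSub x N (app M M′)          = app (plainSub x N M) (plainSub x N M′)
plainSub x N (tens M M′)         = tens (plainSub x N M) (plainSub x N M′)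
plainSub x N (bang M)            = bang (plainSub x N M)
plainSub x N (unbang M)          = unbang (plainSub x N M)
plainSub x N (para M)            = para (plainSub x N M)
plainSub x N (unpara M)          = unpara (plainSub x N M)

Ignores : ℕ → Tm → Set
Ignores y N = ∀ d ρ v → nameless d (extend ρ y v) N ≡ nameless d ρ N

Closed : Tm → Set
Closed N = ∀ d ρ ρ′ → nameless d ρ N ≡ nameless d ρ′ N

NoCapture : ℕ → Tm → Tm → Set
NoCapture x N (var y)             = ⊤
NoCapture x N (lam (pvar y) M)    = if y ≡ᵇ x then ⊤ else (Ignores y N × NoCapture x N M)
NoCapture x N (lam (ptens P Q) M) = ⊤
NoCapture x N (app M M′)          = NoCapture x N M × NoCapture x N M′
NoCapture x N (tens M M′)         = NoCapture x N M × NoCapture x N M′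
NoCapture x N (bang M)            = NoCapture x N M
NoCapture x N (unbang M)          = NoCapture x N M
NoCapture x N (para M)            = NoCapture x N M
NoCapture x N (unpara M)          = NoCapture x N M

Closed⇒NoCapture : ∀ x N M → Closed N → NoCapture x N M
Closed⇒NoCapture x N (var y) c = tt
Closed⇒NoCapture x N (lam (pvar y) M) c with y ≡ᵇ x
... | true  = tt
... | false = (λ d ρ v → c d _ _) , Closed⇒NoCapture x N M c
Closed⇒NoCapture x N (lam (ptens P Q) M) c = tt
Closed⇒NoCapture x N (app M M′)  c = Closed⇒NoCapture x N M c , Closed⇒NoCapture x N M′ c
Closed⇒NoCapture x N (tens M M′) c = Closed⇒NoCapture x N M c , Closed⇒NoCapture x N M′ c
Closed⇒NoCapture x N (bang M)    c = Closed⇒NoCapture x N M c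
Closed⇒NoCapture x N (unbang M)  c = Closed⇒NoCapture x N M c
Closed⇒NoCapture x N (para M)    c = Closed⇒NoCapture x N M c
Closed⇒NoCapture x N (unpara M)  c = Closed⇒NoCapture x N M c

≡ᵇ-distinct-names : ∀ {u x y} → (y ≡ᵇ x) ≡ false → (u ≡ᵇ x) ≡ true → (u ≡ᵇ y) ≡ true → ⊥
≡ᵇ-distinct-names {u} y≢x u≡x u≡y
  with refl ← ≡ᵇ≡true⇒≡ {u} u≡x | refl ← ≡ᵇ≡true⇒≡ {u} u≡y with () ← trans (sym y≢x) (≡ᵇ-refl u)

argEnv : ℕ → Tm → Env → Env
argEnv x N ρ = extend ρ x (λ d → nameless d ρ N)

nameless-plainSub : ∀ x N M → NoCapture x N M → ∀ d ρ →
                    nameless d ρ (plainSub x N M) ≡ nameless d (argEnv x N ρ) M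
nameless-plainSub x N (var y) nc d ρ with y ≡ᵇ x
... | true  = refl
... | false = refl
nameless-plainSub x N (lam (pvar y) M) nc d ρ with y ≡ᵇ x in y≡ᵇx
... | true rewrite ≡ᵇ≡true⇒≡ {y} y≡ᵇx = cong dlam (nameless-ext (suc d) _ _ M shadowed)
  where
  shadowed : ∀ u d′ → extend ρ x (bindAt d) u d′ ≡ extend (argEnv x N ρ) x (bindAt d) u d′
  shadowed u d′ with u ≡ᵇ x
  ... | true  = refl
  ... | false = refl
... | false = cong dlam (trans (nameless-plainSub x N M (proj₂ nc) (suc d) _)
                               (nameless-ext (suc d) _ _ M commute))
  where
  commute : ∀ u d′ → argEnv x N (extend ρ y (bindAt d)) u d′ ≡ extend (argEnv x N ρ) y (bindAt d) u d′
  commute u d′ with u ≡ᵇ x in u≡ᵇx | u ≡ᵇ y in u≡ᵇy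
  ... | true  | true  = ⊥-elim (≡ᵇ-distinct-names {u} {x} {y} y≡ᵇx u≡ᵇx u≡ᵇy)
  ... | true  | false = proj₁ nc d′ ρ (bindAt d)
  ... | false | true  = refl
  ... | false | false = refl
nameless-plainSub x N (lam (ptens P Q) M) nc d ρ = refl
nameless-plainSub x N (app M M′) (nc , nc′) d ρ =
  cong₂ dapp (nameless-plainSub x N M nc d ρ) (nameless-plainSub x N M′ nc′ d ρ)
nameless-plainSub x N (tens M M′) (nc , nc′) d ρ =
  cong₂ dtens (nameless-plainSub x N M nc d ρ) (nameless-plainSub x N M′ nc′ d ρ)
nameless-plainSub x N (bang M)   nc d ρ = cong dbang (nameless-plainSub x N M nc d ρ)
nameless-plainSub x N (unbang M) nc d ρ = cong dunbang (nameless-plainSub x N M nc d ρ)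
nameless-plainSub x N (para M)   nc d ρ = cong dpara (nameless-plainSub x N M nc d ρ)
nameless-plainSub x N (unpara M) nc d ρ = cong dunpara (nameless-plainSub x N M nc d ρ)

↠-β : ∀ x M N → NoCapture x N M → app (lam (pvar x) M) N ↠ plainSub x N M
↠-β x M N nc = inj₁ (β refl) ◅ inj₂ (mk≈ sub≈plainSub) ◅ ε
  where
  sub-env : ∀ ρ u d → subEnv [ (x , N) ] ρ u d ≡ argEnv x N ρ u d
  sub-env ρ u d with u ≡ᵇ x
  ... | true  = refl
  ... | false = refl
  sub≈plainSub : ∀ d ρ → nameless d ρ (sub [ (x , N) ] M) ≡ nameless d ρ (plainSub x N M)
  sub≈plainSub d ρ =
    trans (nameless-sub d ρ _ M)
          (trans (nameless-ext d _ _ M (sub-env ρ)) (sym (nameless-plainSub x N M nc d ρ)))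


Scoped : List ℕ → Tm → Set
Scoped xs (var y)             = y ∈ xs
Scoped xs (lam (pvar y) M)    = Scoped (y ∷ xs) M
Scoped xs (lam (ptens _ _) M) = ⊥
Scoped xs (app M N)           = Scoped xs M × Scoped xs N
Scoped xs (tens M N)          = Scoped xs M × Scoped xs N
Scoped xs (bang M)            = Scoped xs M
Scoped xs (unbang M)          = Scoped xs M
Scoped xs (para M)            = Scoped xs M
Scoped xs (unpara M)          = Scoped xs M

ClosedTm : Tm → Set
ClosedTm = Scoped []

Scoped-mono : ∀ {xs ys} M → (∀ {u} → u ∈ xs → u ∈ ys) → Scoped xs M → Scoped ys M
Scoped-mono (var y) incl s = incl s
Scoped-mono (lam (pvar y) M) incl s = Scoped-mono M (λ { (here eq) → here eq ; (there u∈) → there (incl u∈) }) s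
Scoped-mono (app M N)  incl (s , s′) = Scoped-mono M incl s , Scoped-mono N incl s′
Scoped-mono (tens M N) incl (s , s′) = Scoped-mono M incl s , Scoped-mono N incl s′
Scoped-mono (bang M)   incl s = Scoped-mono M incl s
Scoped-mono (unbang M) incl s = Scoped-mono M incl s
Scoped-mono (para M)   incl s = Scoped-mono M incl s
Scoped-mono (unpara M) incl s = Scoped-mono M incl s

ClosedTm⇒Scoped : ∀ {xs} M → ClosedTm M → Scoped xs M
ClosedTm⇒Scoped M = Scoped-mono M (λ ())

Scoped⇒Simple : ∀ {xs} M → Scoped xs M → Simple M
Scoped⇒Simple (var y) s = tt
Scoped⇒Simple (lam (pvar y) M) s = Scoped⇒Simple M s
Scoped⇒Simple (app M N)  (s , s′) = Scoped⇒Simple M s , Scoped⇒Simple N s′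
Scoped⇒Simple (tens M N) (s , s′) = Scoped⇒Simple M s , Scoped⇒Simple N s′
Scoped⇒Simple (bang M)   s = Scoped⇒Simple M s
Scoped⇒Simple (unbang M) s = Scoped⇒Simple M s
Scoped⇒Simple (para M)   s = Scoped⇒Simple M s
Scoped⇒Simple (unpara M) s = Scoped⇒Simple M s

plainSub-Scoped : ∀ {x xs} N M → x ∉ xs → Scoped xs M → plainSub x N M ≡ M
plainSub-Scoped {x} N (var y) x∉ y∈ with y ≡ᵇ x in y≡ᵇx
... | true  = ⊥-elim (x∉ (subst (_∈ _) (≡ᵇ≡true⇒≡ y≡ᵇx) y∈))
... | false = refl
plainSub-Scoped {x} N (lam (pvar y) M) x∉ s with y ≡ᵇ x in y≡ᵇx
... | true  = refl
... | false = cong (lam (pvar y)) (plainSub-Scoped N M x∉y∷ s)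
  where
  x∉y∷ : x ∉ (y ∷ _)
  x∉y∷ (here refl) = case trans (sym y≡ᵇx) (≡ᵇ-refl x) of λ ()
  x∉y∷ (there x∈) = x∉ x∈
plainSub-Scoped N (app M M′)  x∉ (s , s′) = cong₂ app (plainSub-Scoped N M x∉ s) (plainSub-Scoped N M′ x∉ s′)
plainSub-Scoped N (tens M M′) x∉ (s , s′) = cong₂ tens (plainSub-Scoped N M x∉ s) (plainSub-Scoped N M′ x∉ s′)
plainSub-Scoped N (bang M)   x∉ s = cong bang (plainSub-Scoped N M x∉ s)
plainSub-Scoped N (unbang M) x∉ s = cong unbang (plainSub-Scoped N M x∉ s)
plainSub-Scoped N (para M)   x∉ s = cong para (plainSub-Scoped N M x∉ s)
plainSub-Scoped N (unpara M) x∉ s = cong unpara (plainSub-Scoped N M x∉ s)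

plainSub-closed : ∀ x N M → ClosedTm M → plainSub x N M ≡ M
plainSub-closed x N M = plainSub-Scoped N M (λ ())

nameless-Scoped : ∀ {xs} d ρ ρ′ M → Scoped xs M → (∀ u → u ∈ xs → ∀ d′ → ρ u d′ ≡ ρ′ u d′) →
                  nameless d ρ M ≡ nameless d ρ′ M
nameless-Scoped d ρ ρ′ (var y) y∈ h = h y y∈ d
nameless-Scoped d ρ ρ′ (lam (pvar y) M) s h = cong dlam (nameless-Scoped (suc d) _ _ M s h′)
  where
  h′ : ∀ u → u ∈ (y ∷ _) → ∀ d′ → extend ρ y (bindAt d) u d′ ≡ extend ρ′ y (bindAt d) u d′
  h′ u u∈ d′ with u ≡ᵇ y in u≡ᵇy | u∈
  ... | true  | _ = refl
  ... | false | here refl = case trans (sym u≡ᵇy) (≡ᵇ-refl u) of λ ()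
  ... | false | there u∈xs = h u u∈xs d′
nameless-Scoped d ρ ρ′ (app M N) (s , s′) h = cong₂ dapp (nameless-Scoped d ρ ρ′ M s h) (nameless-Scoped d ρ ρ′ N s′ h)
nameless-Scoped d ρ ρ′ (tens M N) (s , s′) h = cong₂ dtens (nameless-Scoped d ρ ρ′ M s h) (nameless-Scoped d ρ ρ′ N s′ h)
nameless-Scoped d ρ ρ′ (bang M)   s h = cong dbang (nameless-Scoped d ρ ρ′ M s h)
nameless-Scoped d ρ ρ′ (unbang M) s h = cong dunbang (nameless-Scoped d ρ ρ′ M s h)
nameless-Scoped d ρ ρ′ (para M)   s h = cong dpara (nameless-Scoped d ρ ρ′ M s h)
nameless-Scoped d ρ ρ′ (unpara M) s h = cong dunpara (nameless-Scoped d ρ ρ′ M s h)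

ClosedTm⇒Closed : ∀ M → ClosedTm M → Closed M
ClosedTm⇒Closed M c d ρ ρ′ = nameless-Scoped d ρ ρ′ M c (λ _ ())

↠-β-closed : ∀ x M N → ClosedTm N → app (lam (pvar x) M) N ↠ plainSub x N M
↠-β-closed x M N c = ↠-β x M N (Closed⇒NoCapture x N M (ClosedTm⇒Closed N c))

scoped? : ∀ xs M → Dec (Scoped xs M)
scoped? xs (var y)             = y ∈? xs
scoped? xs (lam (pvar y) M)    = scoped? (y ∷ xs) M
scoped? xs (lam (ptens _ _) M) = no λ ()
scoped? xs (app M N)           = scoped? xs M ×-dec scoped? xs N
scoped? xs (tens M N)          = scoped? xs M ×-dec scoped? xs N
scoped? xs (bang M)            = scoped? xs M
scoped? xs (unbang M)          = scoped? xs M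
scoped? xs (para M)            = scoped? xs M
scoped? xs (unpara M)          = scoped? xs M

closed : (M : Tm) → {True (scoped? [] M)} → ClosedTm M
closed M {c} = toWitness c

-- Reduction of the programs

infixl 6 _▹_

_▹_ : ∀ {M N N′} → M ↠ N → N ≡ N′ → M ↠ N′
r ▹ refl = r

≡⇒↠ : ∀ {M N} → M ≡ N → M ↠ N
≡⇒↠ refl = ε

≈⇒↠ : ∀ {M N} → M ≈ N → M ↠ N
≈⇒↠ e = inj₂ e ◅ ε

↠-cong : (f : Tm → Tm) → (∀ {M N} → M ⇝ N → f M ⇝ f N) → (∀ {M N} → M ≈ N → f M ≈ f N) →
         ∀ {M N} → M ↠ N → f M ↠ f N
↠-cong f step equal = gmap f (Sum.map step equal)

↠-lam : ∀ x {M N} → M ↠ N → lam (pvar x) M ↠ lam (pvar x) N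
↠-lam x = ↠-cong (lam (pvar x)) c-lam (λ e → mk≈ λ d ρ → cong dlam (≈-nameless e (suc d) _))

↠-appˡ : ∀ N {M M′} → M ↠ M′ → app M N ↠ app M′ N
↠-appˡ N = ↠-cong (λ M → app M N) c-appl (λ e → mk≈ λ d ρ → cong (λ t → dapp t _) (≈-nameless e d ρ))

↠-appʳ : ∀ M {N N′} → N ↠ N′ → app M N ↠ app M N′
↠-appʳ M = ↠-cong (app M) c-appr (λ e → mk≈ λ d ρ → cong (dapp _) (≈-nameless e d ρ))

↠-bang : ∀ {M N} → M ↠ N → bang M ↠ bang N
↠-bang = ↠-cong bang c-bang (λ e → mk≈ λ d ρ → cong dbang (≈-nameless e d ρ))

↠-para : ∀ {M N} → M ↠ N → para M ↠ para N
↠-para = ↠-cong para c-para (λ e → mk≈ λ d ρ → cong dpara (≈-nameless e d ρ))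

↠-unpara : ∀ {M N} → M ↠ N → unpara M ↠ unpara N
↠-unpara = ↠-cong unpara c-unpara (λ e → mk≈ λ d ρ → cong dunpara (≈-nameless e d ρ))

↠-β! : ∀ {M} → unbang (bang M) ↠ M
↠-β! = inj₁ β! ◅ ε

↠-β§ : ∀ {M} → unpara (para M) ↠ M
↠-β§ = inj₁ β§ ◅ ε

iterate : Tm → Tm → ℕ → Tm
iterate G B zero    = B
iterate G B (suc k) = app G (iterate G B k)

iterBang : Tm → Tm → ℕ → Tm
iterBang F B zero    = B
iterBang F B (suc k) = app (unbang F) (iterBang F B k)

iterBang-+ : ∀ F B p q → iterBang F (iterBang F B q) p ≡ iterBang F B (p + q)
iterBang-+ F B zero    q = refl
iterBang-+ F B (suc p) q = cong (app (unbang F)) (iterBang-+ F B p q)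

iterX≡iterBang : ∀ k → iterX k ≡ iterBang (var 0) (var 1) k
iterX≡iterBang zero    = refl
iterX≡iterBang (suc k) = cong (app (unbang (var 0))) (iterX≡iterBang k)

plainSub-iterate : ∀ x N G B k → plainSub x N (iterate G B k) ≡ iterate (plainSub x N G) (plainSub x N B) k
plainSub-iterate x N G B zero    = refl
plainSub-iterate x N G B (suc k) = cong (app (plainSub x N G)) (plainSub-iterate x N G B k)

plainSub-iterBang : ∀ x N F B k → plainSub x N (iterBang F B k) ≡ iterBang (plainSub x N F) (plainSub x N B) k
plainSub-iterBang x N F B zero    = refl
plainSub-iterBang x N F B (suc k) = cong (app (unbang (plainSub x N F))) (plainSub-iterBang x N F B k)

NoCapture-iterBang : ∀ x N F B k → NoCapture x N F → NoCapture x N B → NoCapture x N (iterBang F B k)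
NoCapture-iterBang x N F B zero    nF nB = nB
NoCapture-iterBang x N F B (suc k) nF nB = nF , NoCapture-iterBang x N F B k nF nB

iterate-closed : ∀ G B k → ClosedTm G → ClosedTm B → ClosedTm (iterate G B k)
iterate-closed G B zero    cG cB = cB
iterate-closed G B (suc k) cG cB = cG , iterate-closed G B k cG cB

iterX-Scoped : ∀ k {xs} → Scoped (1 ∷ 0 ∷ xs) (iterX k)
iterX-Scoped zero    = here refl
iterX-Scoped (suc k) = there (here refl) , iterX-Scoped k

num-closed : ∀ k → ClosedTm (num k)
num-closed k = iterX-Scoped k

↠-iterBang : ∀ G B k → iterBang (bang G) B k ↠ iterate G B k
↠-iterBang G B zero    = ε
↠-iterBang G B (suc k) = ↠-appˡ _ ↠-β! ◅◅ ↠-appʳ G (↠-iterBang G B k)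

↠-num-bang : ∀ k G Z → ClosedTm G → ClosedTm Z → app (unpara (app (num k) (bang G))) Z ↠ iterate G Z k
↠-num-bang k G Z cG cZ =
  ↠-appˡ Z (↠-unpara (↠-β-closed 0 _ (bang G) cG))
  ▹ cong (λ t → app (unpara (para (lam (pvar 1) t))) Z)
         (trans (cong (plainSub 0 (bang G)) (iterX≡iterBang k)) (plainSub-iterBang 0 (bang G) (var 0) (var 1) k))
  ◅◅ ↠-appˡ Z ↠-β§
  ◅◅ ↠-appˡ Z (↠-lam 1 (↠-iterBang G (var 1) k))
  ◅◅ ↠-β-closed 1 (iterate G (var 1) k) Z cZ
  ▹ trans (plainSub-iterate 1 Z G (var 1) k) (cong (λ G′ → iterate G′ Z k) (plainSub-closed 1 Z G cG))

↠-num-var : ∀ k z → z ≢ 1 → unpara (app (num k) (var z)) ↠ lam (pvar 1) (iterBang (var z) (var 1) k)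
↠-num-var k z z≢1 =
  ≡⇒↠ (cong (λ t → unpara (app (lam (pvar 0) (para (lam (pvar 1) t))) (var z))) (iterX≡iterBang k))
  ◅◅ ↠-unpara (↠-β 0 _ (var z) (z-ignores-1 , NoCapture-iterBang 0 (var z) (var 0) (var 1) k tt tt))
  ▹ cong (λ t → unpara (para (lam (pvar 1) t))) (plainSub-iterBang 0 (var z) (var 0) (var 1) k)
  ◅◅ ↠-β§
  where
  z-ignores-1 : Ignores 1 (var z)
  z-ignores-1 d ρ v rewrite ≢⇒≡ᵇ≡false z≢1 = refl

iterDB : Nameless → Nameless → ℕ → Nameless
iterDB F B zero    = B
iterDB F B (suc k) = dapp (dunbang F) (iterDB F B k)

nameless-iterBang : ∀ d ρ F B k → nameless d ρ (iterBang F B k) ≡ iterDB (nameless d ρ F) (nameless d ρ B) k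
nameless-iterBang d ρ F B zero    = refl
nameless-iterBang d ρ F B (suc k) = cong (dapp (dunbang (nameless d ρ F))) (nameless-iterBang d ρ F B k)

≈-num : ∀ f b k → f ≢ b → lam (pvar f) (para (lam (pvar b) (iterBang (var f) (var b) k))) ≈ num k
≈-num f b k f≢b = mk≈ λ d ρ → cong dlam (cong dpara (cong dlam
  (trans (nameless-iterBang _ _ (var f) (var b) k)
  (trans (cong₂ (λ F B → iterDB F B k) (f-bound d ρ) (b-bound d ρ))
  (sym (trans (cong (nameless _ _) (iterX≡iterBang k)) (nameless-iterBang _ _ (var 0) (var 1) k)))))))
  where
  f-bound : ∀ d ρ → extend (extend ρ f (bindAt d)) b (bindAt (suc d)) f (suc (suc d)) ≡ dbound d
  f-bound d ρ rewrite ≢⇒≡ᵇ≡false f≢b | ≡ᵇ-refl f = refl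
  b-bound : ∀ d ρ → extend (extend ρ f (bindAt d)) b (bindAt (suc d)) b (suc (suc d)) ≡ dbound (suc d)
  b-bound d ρ rewrite ≡ᵇ-refl b = refl

-- Programs bind pairwise distinct fixed names (numerals use 0 and 1), so that their
-- β-steps are plain substitutions.
add : Tm
add = lam (pvar 2) (lam (pvar 3) (lam (pvar 4) (para (lam (pvar 5)
        (app (unpara (app (var 2) (var 4))) (app (unpara (app (var 3) (var 4))) (var 5)))))))

↠-num-var-compose : ∀ p q → app (unpara (app (num p) (var 4))) (app (unpara (app (num q) (var 4))) (var 5))
                            ↠ iterBang (var 4) (var 5) (p + q)
↠-num-var-compose p q =
  ↠-appˡ _ (↠-num-var p 4 (λ ()))
  ◅◅ ↠-appʳ _ (↠-appˡ (var 5) (↠-num-var q 4 (λ ())))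
  ◅◅ ↠-appʳ _ (↠-β 1 _ (var 5) (NoCapture-iterBang 1 (var 5) (var 4) (var 1) q tt tt))
  ▹ cong (app _) (plainSub-iterBang 1 (var 5) (var 4) (var 1) q)
  ◅◅ ↠-β 1 _ _ (NoCapture-iterBang 1 _ (var 4) (var 1) p tt tt)
  ▹ trans (plainSub-iterBang 1 _ (var 4) (var 1) p) (iterBang-+ (var 4) (var 5) p q)

add-↠ : ∀ p q → app (app add (num p)) (num q) ↠ num (p + q)
add-↠ p q =
  ↠-appˡ (num q) (↠-β-closed 2 _ (num p) (num-closed p))
  ◅◅ ↠-β-closed 3 _ (num q) (num-closed q)
  ▹ cong (λ P → lam (pvar 4) (para (lam (pvar 5)
                  (app (unpara (app P (var 4))) (app (unpara (app (num q) (var 4))) (var 5))))))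
         (plainSub-closed 3 (num q) (num p) (num-closed p))
  ◅◅ ↠-lam 4 (↠-para (↠-lam 5 (↠-num-var-compose p q)))
  ◅◅ ≈⇒↠ (≈-num 4 5 (p + q) (λ ()))

succ : Tm
succ = app add (num 1)

succ-↠ : ∀ m → app succ (num m) ↠ num (suc m)
succ-↠ = add-↠ 1

succⁿ-↠ : ∀ m → iterate succ (num 0) m ↠ num m
succⁿ-↠ zero    = ε
succⁿ-↠ (suc m) = ↠-appʳ succ (succⁿ-↠ m) ◅◅ succ-↠ m

lift : Tm
lift = lam (pvar 6) (para (app (unpara (app (var 6) (bang succ))) (num 0)))

lift-↠ : ∀ m → app lift (num m) ↠ para (num m)
lift-↠ m =
  ↠-β-closed 6 _ (num m) (num-closed m)
  ◅◅ ↠-para (↠-num-bang m succ (num 0) (closed succ) (num-closed 0))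
  ◅◅ ↠-para (succⁿ-↠ m)

addTo : Tm → Tm
addTo c = lam (pvar 7) (app (app add (unbang c)) (var 7))

addNum : ℕ → Tm
addNum n = addTo (bang (num n))

addNum-closed : ∀ n → ClosedTm (addNum n)
addNum-closed n = (ClosedTm⇒Scoped add (closed add) , ClosedTm⇒Scoped (num n) (num-closed n)) , here refl

addNumⁿ-↠ : ∀ n k → iterate (addNum n) (num 0) k ↠ num (k * n)
addNumⁿ-↠ n zero    = ε
addNumⁿ-↠ n (suc k) =
  ↠-appʳ (addNum n) (addNumⁿ-↠ n k)
  ◅◅ ↠-β-closed 7 _ (num (k * n)) (num-closed (k * n))
  ▹ cong (λ N → app (app add (unbang (bang N))) (num (k * n))) (plainSub-closed 7 _ (num n) (num-closed n))
  ◅◅ ↠-appˡ _ (↠-appʳ add ↠-β!)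
  ◅◅ add-↠ n (k * n)

mul : Tm
mul = lam (pvar 8) (lam (pvar 9) (para (app (unpara (app (var 9) (bang (addTo (var 8))))) (num 0))))

mul-↠ : ∀ n k → app (app mul (bang (num n))) (num k) ↠ para (num (k * n))
mul-↠ n k =
  ↠-appˡ (num k) (↠-β-closed 8 _ (bang (num n)) (num-closed n))
  ◅◅ ↠-β-closed 9 _ (num k) (num-closed k)
  ▹ cong (λ N → para (app (unpara (app (num k) (bang (addTo (bang N))))) (num 0)))
         (plainSub-closed 9 (num k) (num n) (num-closed n))
  ◅◅ ↠-para (↠-num-bang k (addNum n) (num 0) (addNum-closed n) (num-closed 0))
  ◅◅ ↠-para (addNumⁿ-↠ n k)

succ! : Tm
succ! = lam (pvar 10) (bang (app succ (unbang (var 10))))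

succ!-↠ : ∀ m → app succ! (bang (num m)) ↠ bang (num (suc m))
succ!-↠ m =
  ↠-β-closed 10 _ (bang (num m)) (num-closed m)
  ◅◅ ↠-bang (↠-appʳ succ ↠-β! ◅◅ succ-↠ m)

pair : Tm → Tm → Tm
pair a b = lam (pvar 11) (app (app (var 11) a) b)

↠-pair : ∀ a b F → ClosedTm a → ClosedTm b → ClosedTm F → app (pair a b) F ↠ app (app F a) b
↠-pair a b F ca cb cF =
  ↠-β-closed 11 _ F cF
  ▹ cong₂ (λ a′ b′ → app (app F a′) b′) (plainSub-closed 11 F a ca) (plainSub-closed 11 F b cb)

copies : ℕ → ℕ → Tm
copies zero    m = num 0
copies (suc k) m = pair (bang (num m)) (para (copies k m))

copies-closed : ∀ k m → ClosedTm (copies k m)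
copies-closed zero    m = num-closed 0
copies-closed (suc k) m =
  (here refl , ClosedTm⇒Scoped (num m) (num-closed m)) , ClosedTm⇒Scoped (copies k m) (copies-closed k m)

succCopies : ℕ → Tm
succCopiesCont : ℕ → Tm

succCopies zero    = lam (pvar 12) (var 12)
succCopies (suc k) = lam (pvar 12) (app (var 12) (succCopiesCont k))

succCopiesCont k =
  lam (pvar 13) (lam (pvar 14) (pair (app succ! (var 13)) (para (app (succCopies k) (unpara (var 14))))))

succCopies-closed : ∀ k → ClosedTm (succCopies k)
succCopiesCont-closed : ∀ k → ClosedTm (succCopiesCont k)

succCopies-closed zero    = here refl
succCopies-closed (suc k) = here refl , ClosedTm⇒Scoped (succCopiesCont k) (succCopiesCont-closed k)

succCopiesCont-closed k =
  (here refl , ClosedTm⇒Scoped succ! (closed succ!) , there (there (here refl))) ,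
  ClosedTm⇒Scoped (succCopies k) (succCopies-closed k) , there (here refl)

succCopies-↠ : ∀ k m → app (succCopies k) (copies k m) ↠ copies k (suc m)
succCopies-↠ zero    m = ↠-β-closed 12 (var 12) (num 0) (num-closed 0)
succCopies-↠ (suc k) m =
  ↠-β-closed 12 _ (copies (suc k) m) (copies-closed (suc k) m)
  ▹ cong (app _) (plainSub-closed 12 _ (succCopiesCont k) (succCopiesCont-closed k))
  ◅◅ ↠-pair (bang (num m)) (para (copies k m)) (succCopiesCont k) (num-closed m) (copies-closed k m)
       (succCopiesCont-closed k)
  ◅◅ ↠-appˡ _ (↠-β-closed 13 _ (bang (num m)) (num-closed m))
  ▹ cong (λ S → app (lam (pvar 14) (pair (app succ! (bang (num m))) (para (app S (unpara (var 14))))))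
                    (para (copies k m)))
         (plainSub-closed 13 _ (succCopies k) (succCopies-closed k))
  ◅◅ ↠-β-closed 14 _ (para (copies k m)) (copies-closed k m)
  ▹ cong₂ (λ N S → pair (app succ! (bang N)) (para (app S (unpara (para (copies k m))))))
          (plainSub-closed 14 _ (num m) (num-closed m)) (plainSub-closed 14 _ (succCopies k) (succCopies-closed k))
  ◅◅ ↠-lam 11 (↠-appˡ _ (↠-appʳ (var 11) (succ!-↠ m))
               ◅◅ ↠-appʳ _ (↠-para (↠-appʳ (succCopies k) ↠-β§ ◅◅ succCopies-↠ k m)))

succCopiesⁿ-↠ : ∀ k n → iterate (succCopies k) (copies k 0) n ↠ copies k n
succCopiesⁿ-↠ k zero    = ε
succCopiesⁿ-↠ k (suc n) = ↠-appʳ (succCopies k) (succCopiesⁿ-↠ k n) ◅◅ succCopies-↠ k n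

duplicate : ℕ → Tm
duplicate k = lam (pvar 15) (para (app (unpara (app (var 15) (bang (succCopies k)))) (copies k 0)))

duplicate-closed : ∀ k → ClosedTm (duplicate k)
duplicate-closed k =
  (here refl , ClosedTm⇒Scoped (succCopies k) (succCopies-closed k)) , ClosedTm⇒Scoped (copies k 0) (copies-closed k 0)

duplicate-↠ : ∀ k n → app (duplicate k) (num n) ↠ para (copies k n)
duplicate-↠ k n =
  ↠-β-closed 15 _ (num n) (num-closed n)
  ▹ cong₂ (λ S C → para (app (unpara (app (num n) (bang S))) C))
          (plainSub-closed 15 _ (succCopies k) (succCopies-closed k)) (plainSub-closed 15 _ (copies k 0) (copies-closed k 0))
  ◅◅ ↠-para (↠-num-bang n (succCopies k) (copies k 0) (succCopies-closed k) (copies-closed k 0))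
  ◅◅ ↠-para (succCopiesⁿ-↠ k n)

literal : ℕ → Tm
literal b = iterate succ (num 0) b

literal-closed : ∀ b → ClosedTm (literal b)
literal-closed b = iterate-closed succ (num 0) b (closed succ) (num-closed 0)

hornerAcc : ℕ → ℕ → List ℕ → ℕ
hornerAcc n h []       = h
hornerAcc n h (b ∷ bs) = hornerAcc n (b + h * n) bs

-- horner bs h c consumes one copy of n from c per coefficient, updating h to b + h·n.
horner : List ℕ → Tm
hornerStep : Tm → ℕ → List ℕ → Tm

horner []       = lam (pvar 16) (lam (pvar 17) (para (app lift (unpara (app lift (var 16))))))
horner (b ∷ bs) = lam (pvar 16) (lam (pvar 17) (app (var 17) (hornerStep (var 16) b bs)))

hornerStep h b bs = lam (pvar 18) (lam (pvar 19) (para (app (app (horner bs)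
  (app (app add (literal b)) (unpara (app (app mul (var 18)) h)))) (unpara (var 19)))))

horner-closed : ∀ bs → ClosedTm (horner bs)
hornerStep-Scoped : ∀ {xs} h b bs → Scoped xs h → Scoped xs (hornerStep h b bs)

horner-closed []       = closed (horner [])
horner-closed (b ∷ bs) = here refl , hornerStep-Scoped (var 16) b bs (there (here refl))

hornerStep-Scoped h b bs s =
  (ClosedTm⇒Scoped (horner bs) (horner-closed bs) ,
   (ClosedTm⇒Scoped add (closed add) , ClosedTm⇒Scoped (literal b) (literal-closed b)) ,
   (ClosedTm⇒Scoped mul (closed mul) , there (here refl)) , Scoped-mono h (λ u∈ → there (there u∈)) s) ,
  here refl

plainSub-hornerStep : ∀ N b bs → ClosedTm N → plainSub 16 N (hornerStep (var 16) b bs) ≡ hornerStep N b bs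
plainSub-hornerStep N b bs c
  rewrite plainSub-closed 16 N (horner bs) (horner-closed bs)
        | plainSub-closed 16 N (literal b) (literal-closed b) = refl

literal-↠ : ∀ b → literal b ↠ num b
literal-↠ = succⁿ-↠

hornerStep-↠ : ∀ h b bs n C → ClosedTm C →
  app (app (hornerStep (num h) b bs) (bang (num n))) C
  ↠ para (app (app (horner bs) (num (b + h * n))) (unpara C))
hornerStep-↠ h b bs n C cC =
  ↠-appˡ _ (↠-β-closed 18 _ (bang (num n)) (num-closed n))
  ▹ cong (λ B → app (lam (pvar 19) B) C) substituted₁₈
  ◅◅ ↠-β-closed 19 _ C cC
  ▹ substituted₁₉
  ◅◅ ↠-para (↠-appˡ _ (↠-appʳ _ accumulate))
  where
  accumulate : app (app add (literal b)) (unpara (app (app mul (bang (num n))) (num h))) ↠ num (b + h * n)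
  accumulate =
    ↠-appʳ _ (↠-unpara (mul-↠ n h) ◅◅ ↠-β§)
    ◅◅ ↠-appˡ _ (↠-appʳ add (literal-↠ b))
    ◅◅ add-↠ b (h * n)
  stepBody : Tm → Tm → Tm
  stepBody N R = para (app (app (horner bs) (app (app add (literal b)) (unpara (app (app mul N) (num h))))) (unpara R))
  substituted₁₈ : plainSub 18 (bang (num n)) (stepBody (var 18) (var 19)) ≡ stepBody (bang (num n)) (var 19)
  substituted₁₈ rewrite plainSub-closed 18 (bang (num n)) (horner bs) (horner-closed bs)
                      | plainSub-closed 18 (bang (num n)) (literal b) (literal-closed b)
                      | plainSub-closed 18 (bang (num n)) (num h) (num-closed h) = refl
  substituted₁₉ : plainSub 19 C (stepBody (bang (num n)) (var 19)) ≡ stepBody (bang (num n)) C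
  substituted₁₉ rewrite plainSub-closed 19 C (horner bs) (horner-closed bs)
                    | plainSub-closed 19 C (literal b) (literal-closed b)
                    | plainSub-closed 19 C (num n) (num-closed n)
                    | plainSub-closed 19 C (num h) (num-closed h) = refl

horner-↠ : ∀ bs h n → app (app (horner bs) (num h)) (copies (length bs) n)
                      ↠ paraⁿ (length bs + 2) (num (hornerAcc n h bs))
horner-↠ [] h n =
  ↠-appˡ (num 0) (↠-β-closed 16 _ (num h) (num-closed h))
  ◅◅ ↠-β-closed 17 _ (num 0) (num-closed 0)
  ▹ cong (λ H → para (app lift (unpara (app lift H)))) (plainSub-closed 17 (num 0) (num h) (num-closed h))
  ◅◅ ↠-para (↠-appʳ lift (↠-unpara (lift-↠ h) ◅◅ ↠-β§) ◅◅ lift-↠ h)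
horner-↠ (b ∷ bs) h n =
  ↠-appˡ C (↠-β-closed 16 _ (num h) (num-closed h))
  ▹ cong (λ S → app (lam (pvar 17) (app (var 17) S)) C) (plainSub-hornerStep (num h) b bs (num-closed h))
  ◅◅ ↠-β-closed 17 _ C (copies-closed (suc (length bs)) n)
  ▹ cong (app C) (plainSub-closed 17 C S (hornerStep-Scoped (num h) b bs (num-closed h)))
  ◅◅ ↠-pair (bang (num n)) (para (copies (length bs) n)) S (num-closed n) (copies-closed (length bs) n)
       (hornerStep-Scoped (num h) b bs (num-closed h))
  ◅◅ hornerStep-↠ h b bs n (para (copies (length bs) n)) (copies-closed (length bs) n)
  ◅◅ ↠-para (↠-appʳ _ ↠-β§ ◅◅ horner-↠ bs (b + h * n) n)
  where
  C = copies (suc (length bs)) n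
  S = hornerStep (num h) b bs

translate : List ℕ → ℕ → Tm
translate bs l =
  lam (pvar 20) (para (app (app (horner bs) (literal l)) (unpara (app (duplicate (length bs)) (var 20)))))

translate-closed : ∀ bs l → ClosedTm (translate bs l)
translate-closed bs l =
  (ClosedTm⇒Scoped (horner bs) (horner-closed bs) , ClosedTm⇒Scoped (literal l) (literal-closed l)) ,
  ClosedTm⇒Scoped (duplicate (length bs)) (duplicate-closed (length bs)) , here refl

translate-↠ : ∀ bs l n → app (translate bs l) (num n) ↠ paraⁿ (length bs + 3) (num (hornerAcc n l bs))
translate-↠ bs l n =
  ↠-β-closed 20 _ (num n) (num-closed n)
  ▹ substituted
  ◅◅ ↠-para (↠-appʳ _ (↠-unpara (duplicate-↠ (length bs) n) ◅◅ ↠-β§)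
             ◅◅ ↠-appˡ _ (↠-appʳ (horner bs) (literal-↠ l))
             ◅◅ horner-↠ bs l n)
  ▹ cong (λ k → paraⁿ k (num (hornerAcc n l bs))) (sym (+-suc (length bs) 2))
  where
  substituted : plainSub 20 (num n) (para (app (app (horner bs) (literal l)) (unpara (app (duplicate (length bs)) (var 20)))))
              ≡ para (app (app (horner bs) (literal l)) (unpara (app (duplicate (length bs)) (num n))))
  substituted rewrite plainSub-closed 20 (num n) (horner bs) (horner-closed bs)
                    | plainSub-closed 20 (num n) (literal l) (literal-closed l)
                    | plainSub-closed 20 (num n) (succCopies (length bs)) (succCopies-closed (length bs))
                    | plainSub-closed 20 (num n) (copies (length bs) 0) (copies-closed (length bs) 0) = refl

infix 3 _⊢≈_∶_

_⊢≈_∶_ : Ctx → Tm → Ty → Set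
Γ ⊢≈ K ∶ A = Σ Tm λ M → (M ≈ K) × (Γ ⊢ M ∶ A)

ctxVars-++ : ∀ Γ Δ → ctxVars (Γ ++ Δ) ≡ ctxVars Γ ++ ctxVars Δ
ctxVars-++ []            Δ = refl
ctxVars-++ ((P , _) ∷ Γ) Δ rewrite ctxVars-++ Γ Δ = sym (++-assoc (patVars P) (ctxVars Γ) (ctxVars Δ))

Unique-++⁻ʳ : ∀ (xs : List ℕ) {ys} → Unique (xs ++ ys) → Unique ys
Unique-++⁻ʳ []       u       = u
Unique-++⁻ʳ (x ∷ xs) (_ ∷ u) = Unique-++⁻ʳ xs u

Distinct-++⁻ʳ : ∀ Γ Δ → Distinct (Γ ++ Δ) → Distinct Δ
Distinct-++⁻ʳ Γ Δ u rewrite ctxVars-++ Γ Δ = Unique-++⁻ʳ (ctxVars Γ) u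

AutoDistinct : Ctx → Set
AutoDistinct Γ = True (unique? (ctxVars Γ))

≈-sub : ∀ σ M K K′ → M ≈ K → (∀ d ρ → nameless d (subEnv σ ρ) K ≡ nameless d ρ K′) → sub σ M ≈ K′
≈-sub σ M K K′ M≈K h = mk≈ λ d ρ → trans (nameless-sub d ρ σ M) (trans (≈-nameless M≈K d _) (h d ρ))

⊢≈-ax : ∀ x A → [ (pvar x , A) ] ⊢≈ var x ∶ A
⊢≈-ax x A = var x , ≈-refl , ax x A

⊢≈-⊸r : ∀ x {Γ K A B} → (pvar x , A) ∷ Γ ⊢≈ K ∶ B → Γ ⊢≈ lam (pvar x) K ∶ A ⊸ B
⊢≈-⊸r x (M , M≈K , D) = lam (pvar x) M , mk≈ (λ d ρ → cong dlam (≈-nameless M≈K (suc d) _)) , ⊸r D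

⊢≈-exch : ∀ {Γ Δ K A} → Γ ↭ Δ → Γ ⊢≈ K ∶ A → Δ ⊢≈ K ∶ A
⊢≈-exch p (M , M≈K , D) = M , M≈K , exch p D

⊢≈-weak : ∀ x {Γ K A B} {u : AutoDistinct ((pvar x , A) ∷ Γ)} → Γ ⊢≈ K ∶ B → (pvar x , A) ∷ Γ ⊢≈ K ∶ B
⊢≈-weak x {u = u} (M , M≈K , D) = M , M≈K , weak x (toWitness u) D

⊢≈-∀r : ∀ {Γ K A} → map shiftHyp Γ ⊢≈ K ∶ A → Γ ⊢≈ K ∶ ∀ₜ A
⊢≈-∀r (M , M≈K , D) = M , M≈K , ∀r D

⊢≈-!₀ : ∀ {K B} → [] ⊢≈ K ∶ B → [] ⊢≈ bang K ∶ !ₜ B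
⊢≈-!₀ (M , M≈K , D) = bang M , mk≈ (λ d ρ → cong dbang (≈-nameless M≈K d ρ)) , !₀ D

⊢≈-!₁ : ∀ x {A B K} K′ → [ (pvar x , A) ] ⊢≈ K ∶ B →
        (∀ d ρ → nameless d (subEnv [ (x , unbang (var x)) ] ρ) K ≡ nameless d ρ K′) →
        [ (pvar x , !ₜ A) ] ⊢≈ bang K′ ∶ !ₜ B
⊢≈-!₁ x K′ (M , M≈K , D) h =
  _ , mk≈ (λ d ρ → cong dbang (≈-nameless (≈-sub _ M _ K′ M≈K h) d ρ)) , !₁ x D

⊢≈-§ : ∀ (bs as : List (ℕ × Ty)) {B K} K′ → map hv bs ++ map hv as ⊢≈ K ∶ B →
       (∀ d ρ → nameless d (subEnv (map sub! bs ++ map sub§ as) ρ) K ≡ nameless d ρ K′) →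
       map hv! bs ++ map hv§ as ⊢≈ para K′ ∶ §ₜ B
⊢≈-§ bs as K′ (M , M≈K , D) h =
  _ , mk≈ (λ d ρ → cong dpara (≈-nameless (≈-sub _ M _ K′ M≈K h) d ρ)) , §r bs as D

⊢≈-contr : ∀ x y z {Γ A B K} K′ {_ : AutoDistinct ((pvar z , !ₜ A) ∷ Γ)} →
           (pvar x , !ₜ A) ∷ (pvar y , !ₜ A) ∷ Γ ⊢≈ K ∶ B →
           (∀ d ρ → nameless d (subEnv ((x , var z) ∷ (y , var z) ∷ []) ρ) K ≡ nameless d ρ K′) →
           (pvar z , !ₜ A) ∷ Γ ⊢≈ K′ ∶ B
⊢≈-contr x y z K′ {u} (M , M≈K , D) h = _ , ≈-sub _ M _ K′ M≈K h , contr x y z (toWitness u) D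

⊢≈-cut : ∀ x {Γ Δ A B K₁ K₂} K′ {_ : AutoDistinct (Γ ++ Δ)} → Γ ⊢≈ K₁ ∶ A → (pvar x , A) ∷ Δ ⊢≈ K₂ ∶ B →
         (∀ d ρ → nameless d (argEnv x K₁ ρ) K₂ ≡ nameless d ρ K′) → Γ ++ Δ ⊢≈ K′ ∶ B
⊢≈-cut x {K₁ = K₁} {K₂} K′ {u} (M₁ , M₁≈K₁ , D₁) (M₂ , M₂≈K₂ , D₂) h =
  _ , ≈-sub _ M₂ K₂ K′ M₂≈K₂ (λ d ρ → trans (nameless-ext d _ _ K₂ (cut-env ρ)) (h d ρ)) ,
  cut x (toWitness u) D₁ D₂
  where
  cut-env : ∀ ρ u d → subEnv [ (x , M₁) ] ρ u d ≡ argEnv x K₁ ρ u d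
  cut-env ρ u d with u ≡ᵇ x
  ... | true  = ≈-nameless M₁≈K₁ d ρ
  ... | false = refl

⊢≈-∀l : ∀ B {Γ K A} {_ : AutoDistinct Γ} → Γ ⊢≈ K ∶ ∀ₜ A → Γ ⊢≈ K ∶ substTy 0 B A
⊢≈-∀l B {Γ} {K} {A} {u} (M , M≈K , D) =
  subst (λ Γ′ → Γ′ ⊢≈ K ∶ substTy 0 B A) (++-identityʳ Γ)
    (_ , M≈K , cut 0 (subst Distinct (sym (++-identityʳ Γ)) (toWitness u)) D (∀l {B = B} 0 (ax 0 (substTy 0 B A))))

fresh-∉ : ∀ (xs : List ℕ) x → (∀ {v} → v ∈ xs → v ≢ x) → All (x ≢_) xs
fresh-∉ []       x h = []
fresh-∉ (y ∷ ys) x h = (λ eq → h (here refl) (sym eq)) ∷ fresh-∉ ys x (λ m → h (there m))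

-- Application is a cut against the ⊸l-introduction of a fresh variable f applied to the argument.
⊢≈-app : ∀ {Γ Δ A B K₁ K₂} {_ : AutoDistinct (Γ ++ Δ)} → Γ ⊢≈ K₁ ∶ A ⊸ B → Δ ⊢≈ K₂ ∶ A →
         Γ ++ Δ ⊢≈ app K₁ K₂ ∶ B
⊢≈-app {Γ} {Δ} {A} {B} {K₁} {K₂} {u} (M₁ , M₁≈K₁ , D₁) (M₂ , M₂≈K₂ , D₂) =
  _ , mk≈ applied , cut f (toWitness u) D₁ D₂′
  where
  L = ctxVars Δ ++ allVars M₂
  f = suc (maxL L)
  fΔ-distinct : Distinct ((pvar f , A ⊸ B) ∷ Δ ++ [])
  fΔ-distinct rewrite ++-identityʳ Δ =
    fresh-∉ (ctxVars Δ) f (λ m → ∈⇒≢suc-maxL (∈-++⁺ˡ m)) ∷ Distinct-++⁻ʳ Γ Δ (toWitness u)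
  D₂′ : (pvar f , A ⊸ B) ∷ Δ ⊢ app (var f) M₂ ∶ B
  D₂′ = subst (λ Δ′ → (pvar f , A ⊸ B) ∷ Δ′ ⊢ app (var f) M₂ ∶ B) (++-identityʳ Δ)
              (⊸l f 0 fΔ-distinct D₂ (ax 0 B))
  applied : ∀ d ρ → nameless d ρ (sub [ (f , M₁) ] (app (var f) M₂)) ≡ dapp (nameless d ρ K₁) (nameless d ρ K₂)
  applied d ρ rewrite ≡ᵇ-refl f =
    cong₂ dapp (≈-nameless M₁≈K₁ d ρ)
               (trans (nameless-sub d ρ _ M₂) (trans (nameless-agree d _ _ M₂ f-unused) (≈-nameless M₂≈K₂ d ρ)))
    where
    f-unused : EnvAgreeOn M₂ (subEnv [ (f , M₁) ] ρ) ρ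
    f-unused v m d′ rewrite ≢⇒≡ᵇ≡false (∈⇒≢suc-maxL {xs = L} (∈-++⁺ʳ (ctxVars Δ) m)) = refl

-- Typing the programs

α : Ty
α = tv 0

infix 6 _⦂_

_⦂_ : ℕ → Ty → Hyp
x ⦂ A = pvar x , A

⊢num0 : [] ⊢≈ num 0 ∶ IntTy
⊢num0 = ⊢≈-∀r (⊢≈-⊸r 0 (⊢≈-weak 0 (⊢≈-§ [] [] _ (⊢≈-⊸r 1 (⊢≈-ax 1 α)) (λ d ρ → refl))))

⊢num1 : [] ⊢≈ num 1 ∶ IntTy
⊢num1 = ⊢≈-∀r (⊢≈-⊸r 0 (⊢≈-§ ((0 , α ⊸ α) ∷ []) [] _
          (⊢≈-⊸r 1 (⊢≈-exch (swap _ _ ↭-refl) (⊢≈-app (⊢≈-ax 0 (α ⊸ α)) (⊢≈-ax 1 α)))) (λ d ρ → refl)))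

-- The argument !f of both numerals is shared by contraction of 23 and 24 into 4.
⊢add : [] ⊢≈ add ∶ IntTy ⊸ IntTy ⊸ IntTy
⊢add = ⊢≈-⊸r 2 (⊢≈-⊸r 3 (⊢≈-∀r {Γ = 3 ⦂ IntTy ∷ 2 ⦂ IntTy ∷ []} (⊢≈-⊸r 4 shared)))
  where
  F = α ⊸ α
  compose : 21 ⦂ §ₜ F ∷ 22 ⦂ §ₜ F ∷ []
            ⊢≈ para (lam (pvar 5) (app (unpara (var 21)) (app (unpara (var 22)) (var 5)))) ∶ §ₜ F
  compose = ⊢≈-§ [] ((21 , F) ∷ (22 , F) ∷ []) _
    (⊢≈-⊸r 5 (⊢≈-exch (↭-trans (prep _ (swap _ _ ↭-refl)) (swap _ _ ↭-refl))
      (⊢≈-app (⊢≈-ax 21 F) (⊢≈-app (⊢≈-ax 22 F) (⊢≈-ax 5 α))))) (λ d ρ → refl)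
  first : 2 ⦂ IntTy ∷ 23 ⦂ !ₜ F ∷ 22 ⦂ §ₜ F ∷ []
          ⊢≈ para (lam (pvar 5) (app (unpara (app (var 2) (var 23))) (app (unpara (var 22)) (var 5)))) ∶ §ₜ F
  first = ⊢≈-cut 21 _ (⊢≈-app (⊢≈-∀l α (⊢≈-ax 2 IntTy)) (⊢≈-ax 23 (!ₜ F))) compose (λ d ρ → refl)
  both : 3 ⦂ IntTy ∷ 24 ⦂ !ₜ F ∷ 2 ⦂ IntTy ∷ 23 ⦂ !ₜ F ∷ []
         ⊢≈ para (lam (pvar 5) (app (unpara (app (var 2) (var 23))) (app (unpara (app (var 3) (var 24))) (var 5))))
           ∶ §ₜ F
  both = ⊢≈-cut 22 _ (⊢≈-app (⊢≈-∀l α (⊢≈-ax 3 IntTy)) (⊢≈-ax 24 (!ₜ F)))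
           (⊢≈-exch (↭-trans (prep _ (swap _ _ ↭-refl)) (swap _ _ ↭-refl)) first) (λ d ρ → refl)
  shared : 4 ⦂ !ₜ F ∷ 3 ⦂ IntTy ∷ 2 ⦂ IntTy ∷ []
           ⊢≈ para (lam (pvar 5) (app (unpara (app (var 2) (var 4))) (app (unpara (app (var 3) (var 4))) (var 5))))
             ∶ §ₜ F
  shared = ⊢≈-contr 23 24 4 _
    (⊢≈-exch (↭-trans (shift (23 ⦂ !ₜ F) (3 ⦂ IntTy ∷ 24 ⦂ !ₜ F ∷ 2 ⦂ IntTy ∷ []) []) (prep _ (swap _ _ ↭-refl))) both)
    (λ d ρ → refl)

⊢succ : [] ⊢≈ succ ∶ IntTy ⊸ IntTy
⊢succ = ⊢≈-app ⊢add ⊢num1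

⊢literal : ∀ b → [] ⊢≈ literal b ∶ IntTy
⊢literal zero    = ⊢num0
⊢literal (suc b) = ⊢≈-app ⊢succ (⊢literal b)

⊢iterate : ∀ {A} Z → ClosedTm Z → [] ⊢≈ Z ∶ A →
           25 ⦂ §ₜ (A ⊸ A) ∷ [] ⊢≈ para (app (unpara (var 25)) Z) ∶ §ₜ A
⊢iterate {A} Z cZ ⊢Z = ⊢≈-§ [] ((25 , A ⊸ A) ∷ []) _ (⊢≈-app (⊢≈-ax 25 (A ⊸ A)) ⊢Z)
  (λ d ρ → cong (dapp (dunpara (ρ 25 d))) (ClosedTm⇒Closed Z cZ d _ _))

⊢lift : [] ⊢≈ lift ∶ IntTy ⊸ §ₜ IntTy
⊢lift = ⊢≈-⊸r 6 (⊢≈-cut 25 _ (⊢≈-app (⊢≈-∀l IntTy (⊢≈-ax 6 IntTy)) (⊢≈-!₀ ⊢succ))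
                   (⊢iterate (num 0) (num-closed 0) ⊢num0) (λ d ρ → refl))

⊢mul : [] ⊢≈ mul ∶ !ₜ IntTy ⊸ IntTy ⊸ §ₜ IntTy
⊢mul = ⊢≈-⊸r 8 (⊢≈-⊸r 9 (⊢≈-cut 25 _ (⊢≈-app (⊢≈-∀l IntTy (⊢≈-ax 9 IntTy)) ⊢addTo)
                          (⊢iterate (num 0) (num-closed 0) ⊢num0) (λ d ρ → refl)))
  where
  ⊢addTo : 8 ⦂ !ₜ IntTy ∷ [] ⊢≈ bang (addTo (var 8)) ∶ !ₜ (IntTy ⊸ IntTy)
  ⊢addTo = ⊢≈-!₁ 8 _ (⊢≈-⊸r 7 (⊢≈-exch (swap _ _ ↭-refl) (⊢≈-app (⊢≈-app ⊢add (⊢≈-ax 8 IntTy)) (⊢≈-ax 7 IntTy))))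
             (λ d ρ → refl)

⊢succ! : [] ⊢≈ succ! ∶ !ₜ IntTy ⊸ !ₜ IntTy
⊢succ! = ⊢≈-⊸r 10 (⊢≈-!₁ 10 _ (⊢≈-app ⊢succ (⊢≈-ax 10 IntTy)) (λ d ρ → refl))

-- Copies (k + 1) = ∀α. (!Int ⊸ §Copies k ⊸ α) ⊸ α is the pair type !Int ⊗ §Copies k.
Copies : ℕ → Ty
Copies zero    = IntTy
Copies (suc k) = ∀ₜ ((!ₜ IntTy ⊸ §ₜ (Copies k) ⊸ α) ⊸ α)

shiftTy-Copies : ∀ c k → shiftTy c (Copies k) ≡ Copies k
shiftTy-Copies c zero    = refl
shiftTy-Copies c (suc k) rewrite shiftTy-Copies (suc c) k = refl

substTy-Copies : ∀ j B k → substTy j B (Copies k) ≡ Copies k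
substTy-Copies j B zero    = refl
substTy-Copies j B (suc k) rewrite substTy-Copies (suc j) (shiftTy 0 B) k = refl

⊢copies : ∀ k → [] ⊢≈ copies k 0 ∶ Copies k
⊢copies zero    = ⊢num0
⊢copies (suc k) = ⊢≈-∀r {Γ = []} (⊢≈-⊸r 11 (⊢≈-app (⊢≈-app (⊢≈-ax 11 F) (⊢≈-!₀ ⊢num0))
  (⊢≈-§ [] [] (copies k 0) (⊢copies k) (λ d ρ → ClosedTm⇒Closed (copies k 0) (copies-closed k 0) d _ _))))
  where F = !ₜ IntTy ⊸ §ₜ (Copies k) ⊸ α

⊢Copies-elim : ∀ x k T → x ⦂ Copies (suc k) ∷ [] ⊢≈ var x ∶ (!ₜ IntTy ⊸ §ₜ (Copies k) ⊸ T) ⊸ T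
⊢Copies-elim x k T =
  subst (λ C → x ⦂ Copies (suc k) ∷ [] ⊢≈ var x ∶ (!ₜ IntTy ⊸ §ₜ C ⊸ T) ⊸ T) (substTy-Copies 0 T k)
        (⊢≈-∀l T (⊢≈-ax x (Copies (suc k))))

⊢succCopies : ∀ k → [] ⊢≈ succCopies k ∶ Copies k ⊸ Copies k
⊢succCopiesCont : ∀ k → [] ⊢≈ succCopiesCont k ∶ !ₜ IntTy ⊸ §ₜ (Copies k) ⊸ Copies (suc k)

⊢succCopies zero    = ⊢≈-⊸r 12 (⊢≈-ax 12 IntTy)
⊢succCopies (suc k) = ⊢≈-⊸r 12 (⊢≈-app (⊢Copies-elim 12 k (Copies (suc k))) (⊢succCopiesCont k))

⊢succCopiesCont k =
  ⊢≈-⊸r 13 (⊢≈-⊸r 14 (⊢≈-exch (swap _ _ ↭-refl) (⊢≈-∀r {Γ = 13 ⦂ !ₜ IntTy ∷ 14 ⦂ §ₜ (Copies k) ∷ []}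
    (subst (λ C → 13 ⦂ !ₜ IntTy ∷ 14 ⦂ §ₜ C ∷ [] ⊢≈ lam (pvar 11) paired ∶ F ⊸ α) (sym (shiftTy-Copies 0 k))
      (⊢≈-⊸r 11 (⊢≈-app (⊢≈-app (⊢≈-ax 11 F) (⊢≈-app ⊢succ! (⊢≈-ax 13 (!ₜ IntTy)))) ⊢rest))))))
  where
  F = !ₜ IntTy ⊸ §ₜ (Copies k) ⊸ α
  paired = app (app (var 11) (app succ! (var 13))) (para (app (succCopies k) (unpara (var 14))))
  ⊢rest : 14 ⦂ §ₜ (Copies k) ∷ [] ⊢≈ para (app (succCopies k) (unpara (var 14))) ∶ §ₜ (Copies k)
  ⊢rest = ⊢≈-§ [] ((14 , Copies k) ∷ []) _ (⊢≈-app (⊢succCopies k) (⊢≈-ax 14 (Copies k)))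
    (λ d ρ → cong (λ S → dapp S (dunpara (ρ 14 d))) (ClosedTm⇒Closed (succCopies k) (succCopies-closed k) d _ _))

⊢duplicate : ∀ k → [] ⊢≈ duplicate k ∶ IntTy ⊸ §ₜ (Copies k)
⊢duplicate k = ⊢≈-⊸r 15 (⊢≈-cut 25 _ (⊢≈-app (⊢≈-∀l (Copies k) (⊢≈-ax 15 IntTy)) (⊢≈-!₀ (⊢succCopies k)))
  (⊢iterate (copies k 0) (copies-closed k 0) (⊢copies k))
  (λ d ρ → cong (λ C → dpara (dapp (dunpara (dapp (ρ 15 d) (dbang (nameless d ρ (succCopies k))))) C))
                (ClosedTm⇒Closed (copies k 0) (copies-closed k 0) d _ _)))

⊢horner : ∀ bs → [] ⊢≈ horner bs ∶ IntTy ⊸ Copies (length bs) ⊸ §ⁿ (length bs + 2) IntTy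
⊢horner [] = ⊢≈-⊸r 16 (⊢≈-⊸r 17 (⊢≈-weak 17 (⊢≈-cut 26 _ (⊢≈-app ⊢lift (⊢≈-ax 16 IntTy))
  (⊢≈-§ [] ((26 , IntTy) ∷ []) (app lift (unpara (var 26))) (⊢≈-app ⊢lift (⊢≈-ax 26 IntTy)) (λ d ρ → refl))
  (λ d ρ → refl))))
⊢horner (b ∷ bs) = ⊢≈-⊸r 16 (⊢≈-⊸r 17 (⊢≈-app (⊢Copies-elim 17 k Result) ⊢step))
  where
  k = length bs
  Result = §ₜ (§ⁿ (k + 2) IntTy)
  hornerAt : ∀ d {ρ ρ′} → nameless d ρ (horner bs) ≡ nameless d ρ′ (horner bs)
  hornerAt d = ClosedTm⇒Closed (horner bs) (horner-closed bs) d _ _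
  literalAt : ∀ d {ρ ρ′} → nameless d ρ (literal b) ≡ nameless d ρ′ (literal b)
  literalAt d = ClosedTm⇒Closed (literal b) (literal-closed b) d _ _
  inner : 27 ⦂ IntTy ∷ 19 ⦂ Copies k ∷ []
          ⊢≈ app (app (horner bs) (app (app add (literal b)) (var 27))) (var 19) ∶ §ⁿ (k + 2) IntTy
  inner = ⊢≈-app (⊢≈-app (⊢horner bs) (⊢≈-app (⊢≈-app ⊢add (⊢literal b)) (⊢≈-ax 27 IntTy))) (⊢≈-ax 19 (Copies k))
  ⊢recurse : 27 ⦂ §ₜ IntTy ∷ 19 ⦂ §ₜ (Copies k) ∷ []
             ⊢≈ para (app (app (horner bs) (app (app add (literal b)) (unpara (var 27)))) (unpara (var 19))) ∶ Result
  ⊢recurse = ⊢≈-§ [] ((27 , IntTy) ∷ (19 , Copies k) ∷ []) _ inner λ d ρ →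
    cong₂ (λ H L → dapp (dapp H (dapp (dapp (nameless d ρ add) L) (dunpara (ρ 27 d)))) (dunpara (ρ 19 d)))
          (hornerAt d) (literalAt d)
  ⊢body : 18 ⦂ !ₜ IntTy ∷ 16 ⦂ IntTy ∷ 19 ⦂ §ₜ (Copies k) ∷ []
          ⊢≈ para (app (app (horner bs) (app (app add (literal b)) (unpara (app (app mul (var 18)) (var 16)))))
                       (unpara (var 19))) ∶ Result
  ⊢body = ⊢≈-cut 27 _ (⊢≈-app (⊢≈-app ⊢mul (⊢≈-ax 18 (!ₜ IntTy))) (⊢≈-ax 16 IntTy)) ⊢recurse λ d ρ →
    cong₂ (λ H L → dpara (dapp (dapp H (dapp (dapp (nameless d ρ add) L)
                                 (dunpara (nameless d ρ (app (app mul (var 18)) (var 16)))))) (dunpara (ρ 19 d))))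
          (hornerAt d) (literalAt d)
  ⊢step : 16 ⦂ IntTy ∷ [] ⊢≈ hornerStep (var 16) b bs ∶ !ₜ IntTy ⊸ §ₜ (Copies k) ⊸ Result
  ⊢step = ⊢≈-⊸r 18 (⊢≈-⊸r 19 (⊢≈-exch (shift (19 ⦂ §ₜ (Copies k)) (18 ⦂ !ₜ IntTy ∷ 16 ⦂ IntTy ∷ []) []) ⊢body))

⊢translate : ∀ bs l → [] ⊢≈ translate bs l ∶ IntTy ⊸ §ₜ (§ⁿ (length bs + 2) IntTy)
⊢translate bs l = ⊢≈-⊸r 20 (⊢≈-cut 29 _ (⊢≈-app (⊢duplicate k) (⊢≈-ax 20 IntTy))
  (⊢≈-§ [] ((29 , Copies k) ∷ []) (app (app (horner bs) (literal l)) (unpara (var 29))) (⊢≈-app (⊢≈-app (⊢horner bs) (⊢literal l)) (⊢≈-ax 29 (Copies k)))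
     (λ d ρ → cong₂ (λ H L → dapp (dapp H L) (dunpara (ρ 29 d))) (hornerAt d) (literalAt d)))
  (λ d ρ → cong₂ (λ H L → dpara (dapp (dapp H L) (dunpara (nameless d ρ (app (duplicate k) (var 20))))))
                 (hornerAt d) (literalAt d)))
  where
  k = length bs
  hornerAt : ∀ d {ρ ρ′} → nameless d ρ (horner bs) ≡ nameless d ρ′ (horner bs)
  hornerAt d = ClosedTm⇒Closed (horner bs) (horner-closed bs) d _ _
  literalAt : ∀ d {ρ ρ′} → nameless d ρ (literal l) ≡ nameless d ρ′ (literal l)
  literalAt d = ClosedTm⇒Closed (literal l) (literal-closed l) d _ _

hornerAcc-∷ʳ : ∀ n h xs x → hornerAcc n h (xs ∷ʳ x) ≡ x + hornerAcc n h xs * n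
hornerAcc-∷ʳ n h []       x = refl
hornerAcc-∷ʳ n h (y ∷ xs) x = hornerAcc-∷ʳ n (y + h * n) xs x

evalL≡hornerAcc-reverse : ∀ as n → evalL as n ≡ hornerAcc n 0 (reverse as)
evalL≡hornerAcc-reverse []       n = refl
evalL≡hornerAcc-reverse (a ∷ as) n = begin
  a + n * evalL as n                      ≡⟨ cong (a +_) (*-comm n (evalL as n)) ⟩
  a + evalL as n * n                      ≡⟨ cong (λ v → a + v * n) (evalL≡hornerAcc-reverse as n) ⟩
  a + hornerAcc n 0 (reverse as) * n      ≡⟨ hornerAcc-∷ʳ n 0 (reverse as) a ⟨
  hornerAcc n 0 (reverse as ∷ʳ a)         ≡⟨ cong (hornerAcc n 0) (unfold-reverse a as) ⟨
  hornerAcc n 0 (reverse (a ∷ as))        ∎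
  where open ≡-Reasoning

-- The coefficients are given leading one first; that one starts the accumulator, so that
-- horner only needs as many copies of the argument as the degree.
translateCoeffs : List ℕ → Tm
translateCoeffs []       = translate [] 0
translateCoeffs (l ∷ bs) = translate bs l

translateCoeffs-closed : ∀ rs → ClosedTm (translateCoeffs rs)
translateCoeffs-closed []       = translate-closed [] 0
translateCoeffs-closed (l ∷ bs) = translate-closed bs l

translateCoeffs-↠ : ∀ rs n → app (translateCoeffs rs) (num n) ↠ paraⁿ (pred (length rs) + 3) (num (hornerAcc n 0 rs))
translateCoeffs-↠ []       n = translate-↠ [] 0 n
translateCoeffs-↠ (l ∷ bs) n rewrite +-identityʳ l = translate-↠ bs l n

⊢translateCoeffs : ∀ rs → [] ⊢≈ translateCoeffs rs ∶ IntTy ⊸ §ⁿ (pred (length rs) + 3) IntTy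
⊢translateCoeffs []       = ⊢translate [] 0
⊢translateCoeffs (l ∷ bs) rewrite +-suc (length bs) 2 = ⊢translate bs l

translateP : Poly → Tm
translateP p = translateCoeffs (reverse (proj₁ p))

degree≡ : ∀ p → degree p ≡ pred (length (reverse (proj₁ p)))
degree≡ p = cong pred (sym (length-reverse (proj₁ p)))

translateP-↠ : ∀ p n → app (translateP p) (num n) ↠ paraⁿ (degree p + 3) (num (evalP p n))
translateP-↠ p n rewrite degree≡ p | evalL≡hornerAcc-reverse (proj₁ p) n =
  translateCoeffs-↠ (reverse (proj₁ p)) n

translateP-Simple : ∀ p n → Simple (app (translateP p) (num n))
translateP-Simple p n =
  Scoped⇒Simple (app (translateP p) (num n)) (translateCoeffs-closed (reverse (proj₁ p)) , num-closed n)

⊢≈⇒Derivable : ∀ {K A} → Simple K → [] ⊢≈ K ∶ A → Derivable K A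
⊢≈⇒Derivable sK (M , M≈K , D) = M , ≈⇒=α (Simple-≈ sK (≈-sym M≈K)) M≈K , D

translateP-Derivable : ∀ p → Derivable (translateP p) (IntTy ⊸ §ⁿ (degree p + 3) IntTy)
translateP-Derivable p rewrite degree≡ p =
  ⊢≈⇒Derivable (proj₁ (translateP-Simple p 0)) (⊢translateCoeffs (reverse (proj₁ p)))

↠-numeral⇔ : ∀ {M} k v m → Simple M → M ↠ paraⁿ k (num v) → (v ≡ m) ⇔ (M ⇝* paraⁿ k (num m))
↠-numeral⇔ k v m s M↠v = mk⇔ (λ { refl → ↠⇒⇝* s M↠v }) (↠-numeral-unique k v m s M↠v)

mainTheorem7 : Σ (Poly → Tm) λ tr → (p : Poly) →
    Derivable (tr p) (IntTy ⊸ §ⁿ (degree p + 3) IntTy)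
    × ((n m : ℕ) → (evalP p n ≡ m) ⇔ (app (tr p) (num n) ⇝* paraⁿ (degree p + 3) (num m)))
mainTheorem7 = translateP , λ p →
  translateP-Derivable p ,
  λ n m → ↠-numeral⇔ (degree p + 3) (evalP p n) m (translateP-Simple p n) (translateP-↠ p n)
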